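{- Let $p\ge 5$ be a prime such that $X^3-X-1$ has fewer than $3$ distinct roots in $\mathbb{F}_p$. A $\Phi_{p-3}$-sequence $(a_n)_{n\in\mathbb{Z}}$ in $\mathbb{F}_p$ is a complete $\Phi_{p-3}$-sequence if and only if $a_n=b^n$ for all $n$, where $b$ is a $\Phi_{p-3}$-primitive root.
   Context: For a prime $p\ge 5$ and $\kappa\in\{2,\dots,p-2\}$, a sequence $(a_n)_{n\in\mathbb{Z}}$ of elements of $\mathbb{F}_p$ is a $\Phi_\kappa$-sequence if $a_0=1$ and $a_{n+\kappa}=a_n+a_{n+1}$ in $\mathbb{F}_p$ for all $n\in\mathbb{Z}$. It is complete if it is periodic with period $p-1$ and $\{a_1,\dots,a_{p-2}\}=\{2,\dots,p-1\}$. A $\Phi_\kappa$-primitive root is a primitive root $b$ mod $p$ (in $\mathbb{F}_p$) with $b^\kappa=b+1$. -}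

module Defs where

open import Data.Nat as ℕ using (ℕ; zero; suc; NonZero; _≤_; _<_; _∸_)
open import Data.Nat.DivMod using (_mod_)
open import Data.Fin using (Fin; toℕ)
open import Data.Integer as ℤ using (ℤ; +_; -[1+_])
open import Data.Product using (Σ; _×_; ∃)
open import Relation.Binary.PropositionalEquality using (_≡_; _≢_)
open import Relation.Nullary using (¬_)

module _ {p : ℕ} .{{_ : NonZero p}} where

  𝔽 : Set
  𝔽 = Fin p

  infixl 6 _⊕_ _⊖_
  infixl 7 _⊗_

  _⊕_ : Fin p → Fin p → Fin p
  x ⊕ y = (toℕ x ℕ.+ toℕ y) mod p

  _⊗_ : Fin p → Fin p → Fin p
  x ⊗ y = (toℕ x ℕ.* toℕ y) mod p

  _⊖_ : Fin p → Fin p → Fin p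
  x ⊖ y = (toℕ x ℕ.+ (p ∸ toℕ y)) mod p

  𝟘 𝟙 : Fin p
  𝟘 = 0 mod p
  𝟙 = 1 mod p

  _^_ : Fin p → ℕ → Fin p
  b ^ zero  = 𝟙
  b ^ suc k = b ⊗ (b ^ k)

  -- x = b^n for an integer exponent n (b invertible):
  -- for n = k ≥ 0 this is x = b^k, for n = -(k+1) it says x · b^(k+1) = 1,
  -- i.e. x = (b^(k+1))⁻¹ = b^n.
  IsPowZ : Fin p → ℤ → Fin p → Set
  IsPowZ b (+ k)      x = x ≡ b ^ k
  IsPowZ b -[1+ k ]   x = x ⊗ (b ^ suc k) ≡ 𝟙

  IsΦSeq : ℕ → (ℤ → Fin p) → Set
  IsΦSeq κ a = (a (+ 0) ≡ 𝟙) × (∀ n → a (n ℤ.+ + κ) ≡ a n ⊕ a (n ℤ.+ + 1))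

  IsComplete : (ℤ → Fin p) → Set
  IsComplete a =
    (∀ n → a (n ℤ.+ + (p ∸ 1)) ≡ a n)
    × (∀ (i : ℕ) → 1 ≤ i → i ≤ p ∸ 2 → 2 ≤ toℕ (a (+ i)))
    × (∀ (y : Fin p) → 2 ≤ toℕ y →
         Σ ℕ λ i → (1 ≤ i) × (i ≤ p ∸ 2) × (a (+ i) ≡ y))

  IsPrimitiveRoot : Fin p → Set
  IsPrimitiveRoot b = (b ^ (p ∸ 1) ≡ 𝟙) × (∀ k → 1 ≤ k → k < p ∸ 1 → b ^ k ≢ 𝟙)

  IsΦPrimitiveRoot : ℕ → Fin p → Set
  IsΦPrimitiveRoot κ b = IsPrimitiveRoot b × (b ^ κ ≡ b ⊕ 𝟙)

  IsCubicRoot : Fin p → Set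
  IsCubicRoot x = (x ^ 3) ⊖ x ⊖ 𝟙 ≡ 𝟘

  FewerThan3Roots : Set
  FewerThan3Roots =
    ¬ (Σ (Fin p) λ x → Σ (Fin p) λ y → Σ (Fin p) λ z →
         IsCubicRoot x × IsCubicRoot y × IsCubicRoot z
         × (x ≢ y) × (y ≢ z) × (x ≢ z))

{-# OPTIONS --safe #-}
-- Write N = p - 1. Periodicity turns the Φ_{p-3} recurrence a_{n+p-3} = a_n + a_{n+1} into
-- a_n = a_{n+2} + a_{n+3}, so the transform T(c) = Σ_{n<N} a_n cⁿ satisfies T(c)·(c³ - c - 1) = 0
-- whenever cᴺ = 1. The power sums Σ_{c ∈ 𝔽ₚ} cᵉ vanish for e < N and equal -1 for e = N, which
-- gives the inversion formula -a_m = Σ_c T(c)·c^{N-m}; only roots r of X³ - X - 1 contribute.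
-- Since a_0 = 1 there is a root; with a single root r the sequence is a_m = (r⁻¹)^m. Two distinct
-- roots r, s force -(r + s) to be a third one, so with fewer than three roots the cubic has a
-- repeated root and p divides its discriminant -23; for p = 23 a direct computation shows that
-- one of the two coefficients T(r), T(s) vanishes as soon as a_1, …, a_{21} avoid 0 and 1.
-- Either way a_m = b^m, completeness makes b a primitive root, and conversely the powers of a
-- primitive root are complete by the pigeonhole principle.
module Submission where

open import Algebra.Bundles using (AbelianGroup; CommutativeMonoid; CommutativeRing)
open import Algebra.Consequences.Propositional using (comm∧idˡ⇒id; comm∧invˡ⇒inv; comm∧distrˡ⇒distr)
open import Algebra.Structures using (IsCommutativeRing)
import Algebra.Properties.CommutativeSemigroup as CommutativeSemigroupProperties
import Algebra.Properties.CommutativeSemiring.Binomial as BinomialProperties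
import Algebra.Properties.Group as GroupProperties
import Algebra.Properties.Ring as RingProperties
import Algebra.Properties.Semiring.Mult as MultProperties
import Algebra.Properties.Semiring.Sum as SemiringSumProperties
open import Data.Empty using (⊥-elim)
open import Data.Fin as Fin using (Fin; zero; suc; toℕ)
import Data.Fin.Properties as Finₚ
open import Data.Integer as ℤ using (ℤ; +_; -[1+_]) renaming (_⊖_ to _⊝_)
import Data.Integer.Properties as ℤ
open import Data.Integer.Tactic.RingSolver using (solve-∀)
open import Data.Maybe using (Maybe; just; nothing)
open import Data.Nat as ℕ using (ℕ; zero; suc; NonZero; _∸_; _%_; _<_; _≤_; z≤n; s≤s; _!)
open import Data.Nat.DivMod using (_mod_; _/_; m/n*n≡m; m<n⇒m%n≡m; n%n≡0; %-distribˡ-+; %-distribˡ-*)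
open import Data.Nat.Divisibility using (_∣_; m%n≡0⇒n∣m; ∣⇒≤)
open import Data.Nat.Induction using (<-rec)
open import Data.Nat.Primality using (Prime; prime⇒nonTrivial; euclidsLemma; prime?; prime⇒irreducible)
import Data.Nat.Properties as ℕ
open import Data.Nat.Properties using (_!*_!≢0)
open import Data.Product using (Σ; _×_; _,_; ∃; proj₁; proj₂)
open import Data.Sum as Sum using (_⊎_; inj₁; inj₂)
open import Data.Vec.Functional using (Vector)
open import Function using (_∘_; id)
open import Function.Bundles using (_⇔_; mk⇔)
open import Level using (0ℓ)
open import Relation.Binary.Definitions using (DecidableEquality; tri<; tri≈; tri>)
import Relation.Binary.PropositionalEquality as ≡
open ≡ using (_≡_; _≢_; cong; cong₂; module ≡-Reasoning)
open import Relation.Nullary using (¬_; Dec; yes; no; contradiction)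
open import Relation.Nullary.Decidable using (decidable-stable; from-yes; toWitness; _→-dec_; _⊎-dec_; _×-dec_; ¬?)

open import Defs

private

  m⊝n≡+m-+n : ∀ m n → m ⊝ n ≡ + m ℤ.- + n
  m⊝n≡+m-+n m n = ≡.sym (ℤ.[+m]-[+n]≡m⊖n m n)

  ⊝-+-⊝ : ∀ a b c d → (a ⊝ b) ℤ.+ (c ⊝ d) ≡ (a ℕ.+ c) ⊝ (b ℕ.+ d)
  ⊝-+-⊝ a b c d = begin
    (a ⊝ b) ℤ.+ (c ⊝ d)                      ≡⟨ cong₂ ℤ._+_ (m⊝n≡+m-+n a b) (m⊝n≡+m-+n c d) ⟩
    (+ a ℤ.- + b) ℤ.+ (+ c ℤ.- + d)          ≡⟨ identity (+ a) (+ b) (+ c) (+ d) ⟩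
    (+ a ℤ.+ + c) ℤ.- (+ b ℤ.+ + d)          ≡⟨ cong₂ ℤ._-_ (ℤ.pos-+ a c) (ℤ.pos-+ b d) ⟨
    + (a ℕ.+ c) ℤ.- + (b ℕ.+ d)              ≡⟨ m⊝n≡+m-+n (a ℕ.+ c) (b ℕ.+ d) ⟨
    (a ℕ.+ c) ⊝ (b ℕ.+ d)                    ∎
    where
    open ≡-Reasoning
    identity : ∀ a b c d → (a ℤ.- b) ℤ.+ (c ℤ.- d) ≡ (a ℤ.+ c) ℤ.- (b ℤ.+ d)
    identity = solve-∀

  pos-*-+-* : ∀ a b c d → + a ℤ.* + b ℤ.+ + c ℤ.* + d ≡ + (a ℕ.* b ℕ.+ c ℕ.* d)
  pos-*-+-* a b c d = ≡.sym (≡.trans (ℤ.pos-+ (a ℕ.* b) (c ℕ.* d)) (cong₂ ℤ._+_ (ℤ.pos-* a b) (ℤ.pos-* c d)))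

  ⊝-*-⊝ : ∀ a b c d → (a ⊝ b) ℤ.* (c ⊝ d) ≡ (a ℕ.* c ℕ.+ b ℕ.* d) ⊝ (a ℕ.* d ℕ.+ b ℕ.* c)
  ⊝-*-⊝ a b c d = begin
    (a ⊝ b) ℤ.* (c ⊝ d)                      ≡⟨ cong₂ ℤ._*_ (m⊝n≡+m-+n a b) (m⊝n≡+m-+n c d) ⟩
    (+ a ℤ.- + b) ℤ.* (+ c ℤ.- + d)          ≡⟨ identity (+ a) (+ b) (+ c) (+ d) ⟩
    (+ a ℤ.* + c ℤ.+ + b ℤ.* + d) ℤ.- (+ a ℤ.* + d ℤ.+ + b ℤ.* + c)
      ≡⟨ cong₂ ℤ._-_ (pos-*-+-* a c b d) (pos-*-+-* a d b c) ⟩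
    + (a ℕ.* c ℕ.+ b ℕ.* d) ℤ.- + (a ℕ.* d ℕ.+ b ℕ.* c)
      ≡⟨ m⊝n≡+m-+n (a ℕ.* c ℕ.+ b ℕ.* d) (a ℕ.* d ℕ.+ b ℕ.* c) ⟨
    (a ℕ.* c ℕ.+ b ℕ.* d) ⊝ (a ℕ.* d ℕ.+ b ℕ.* c) ∎
    where
    open ≡-Reasoning
    identity : ∀ a b c d → (a ℤ.- b) ℤ.* (c ℤ.- d) ≡ (a ℤ.* c ℤ.+ b ℤ.* d) ℤ.- (a ℤ.* d ℤ.+ b ℤ.* c)
    identity = solve-∀

≢fromℕ⇒toℕ< : ∀ {n} (i : Fin (suc n)) → i ≢ Fin.fromℕ n → toℕ i < n
≢fromℕ⇒toℕ< {zero}  zero    i≢n = contradiction ≡.refl i≢n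
≢fromℕ⇒toℕ< {suc n} zero    _   = s≤s z≤n
≢fromℕ⇒toℕ< {suc n} (suc i) i≢n = s≤s (≢fromℕ⇒toℕ< i (i≢n ∘ cong suc))

periodic-agree : ∀ {a} {A : Set a} {N} → 0 < N → (f g : ℕ → A) → (∀ n → f (n ℕ.+ N) ≡ f n) → (∀ n → g (n ℕ.+ N) ≡ g n) →
                 (∀ (m : Fin N) → f (toℕ m) ≡ g (toℕ m)) → ∀ n → f n ≡ g n
periodic-agree {N = N} 0<N f g f-periodic g-periodic agree = <-rec (λ n → f n ≡ g n) step
  where
  step : ∀ n → (∀ {m} → m < n → f m ≡ g m) → f n ≡ g n
  step n earlier with n ℕ.<? N
  ... | yes n<N = ≡.trans (cong f (≡.sym (Finₚ.toℕ-fromℕ< n<N))) (≡.trans (agree (Fin.fromℕ< n<N)) (cong g (Finₚ.toℕ-fromℕ< n<N)))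
  ... | no n≮N  = begin
    f n                 ≡⟨ cong f n≡n-N+N ⟨
    f (n ∸ N ℕ.+ N)     ≡⟨ f-periodic (n ∸ N) ⟩
    f (n ∸ N)           ≡⟨ earlier (ℕ.∸-monoʳ-< 0<N (ℕ.≮⇒≥ n≮N)) ⟩
    g (n ∸ N)           ≡⟨ g-periodic (n ∸ N) ⟨
    g (n ∸ N ℕ.+ N)     ≡⟨ cong g n≡n-N+N ⟩
    g n                 ∎
    where
    open ≡-Reasoning
    n≡n-N+N : n ∸ N ℕ.+ N ≡ n
    n≡n-N+N = ℕ.m∸n+n≡m (ℕ.≮⇒≥ n≮N)

periodicℤ-iterate : ∀ {a} {A : Set a} (f : ℤ → A) {N} → (∀ z → f (z ℤ.+ + N) ≡ f z) →
                    ∀ q z → f (z ℤ.+ + (N ℕ.* q)) ≡ f z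
periodicℤ-iterate f {N} periodic zero    z = cong f (≡.trans (cong (λ n → z ℤ.+ + n) (ℕ.*-zeroʳ N)) (ℤ.+-identityʳ z))
periodicℤ-iterate f {N} periodic (suc q) z = begin
  f (z ℤ.+ + (N ℕ.* suc q))            ≡⟨ cong f shift ⟩
  f (z ℤ.+ + (N ℕ.* q) ℤ.+ + N)        ≡⟨ periodic (z ℤ.+ + (N ℕ.* q)) ⟩
  f (z ℤ.+ + (N ℕ.* q))                ≡⟨ periodicℤ-iterate f periodic q z ⟩
  f z                                  ∎
  where
  open ≡-Reasoning
  shift : z ℤ.+ + (N ℕ.* suc q) ≡ z ℤ.+ + (N ℕ.* q) ℤ.+ + N
  shift = begin
    z ℤ.+ + (N ℕ.* suc q)              ≡⟨ cong (λ n → z ℤ.+ + n) (ℕ.*-suc N q) ⟩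
    z ℤ.+ + (N ℕ.+ N ℕ.* q)            ≡⟨ cong (λ w → z ℤ.+ w) (ℤ.pos-+ N (N ℕ.* q)) ⟩
    z ℤ.+ (+ N ℤ.+ + (N ℕ.* q))        ≡⟨ cong (λ w → z ℤ.+ w) (ℤ.+-comm (+ N) (+ (N ℕ.* q))) ⟩
    z ℤ.+ (+ (N ℕ.* q) ℤ.+ + N)        ≡⟨ ℤ.+-assoc z (+ (N ℕ.* q)) (+ N) ⟨
    z ℤ.+ + (N ℕ.* q) ℤ.+ + N          ∎

module IntegerCoefficientRingSolver {r ℓ} (R : CommutativeRing r ℓ) where

  open CommutativeRing R
  module Mult = MultProperties semiring

  -- The solver interprets an integer constant through numeral, so that the identities it proves
  -- mention the ring's own numerals (in 𝔽ₚ: ⟦ 23 ⟧ rather than the unfolded sum 1# + (1# + …)).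
  module Numerals (numeral : ℕ → Carrier) (numeral≈×1 : ∀ n → numeral n ≈ n Mult.× 1#) where

    open Mult using (×-homo-+; ×1-homo-*)
    open import Algebra.Properties.AbelianGroup +-abelianGroup using (⁻¹-∙-comm; ⁻¹-anti-homo‿-; ε⁻¹≈ε)
    open import Algebra.Properties.CommutativeSemigroup +-commutativeSemigroup using (interchange)
    open import Algebra.Properties.Ring ring using (x[y-z]≈xy-xz; [y-z]x≈yx-zx)
    import Algebra.Solver.Ring.AlmostCommutativeRing as ACR
    open import Relation.Binary.Reasoning.Setoid setoid

    private
      ν = numeral

      ν-homo-+ : ∀ m n → ν (m ℕ.+ n) ≈ ν m + ν n
      ν-homo-+ m n = trans (numeral≈×1 (m ℕ.+ n)) (trans (×-homo-+ 1# m n) (sym (+-cong (numeral≈×1 m) (numeral≈×1 n))))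

      ν-homo-* : ∀ m n → ν (m ℕ.* n) ≈ ν m * ν n
      ν-homo-* m n = trans (numeral≈×1 (m ℕ.* n)) (trans (×1-homo-* m n) (sym (*-cong (numeral≈×1 m) (numeral≈×1 n))))

      [a-b]+[c-d] : ∀ a b c d → (a - b) + (c - d) ≈ (a + c) - (b + d)
      [a-b]+[c-d] a b c d = trans (interchange a (- b) c (- d)) (+-congˡ (⁻¹-∙-comm b d))

      [a-b]*[c-d] : ∀ a b c d → (a - b) * (c - d) ≈ (a * c + b * d) - (a * d + b * c)
      [a-b]*[c-d] a b c d = begin
        (a - b) * (c - d)                      ≈⟨ [y-z]x≈yx-zx (c - d) a b ⟩
        a * (c - d) - b * (c - d)              ≈⟨ +-cong (x[y-z]≈xy-xz a c d) (trans (-‿cong (x[y-z]≈xy-xz b c d)) (⁻¹-anti-homo‿- (b * c) (b * d))) ⟩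
        (a * c - a * d) + (b * d - b * c)      ≈⟨ [a-b]+[c-d] (a * c) (a * d) (b * d) (b * c) ⟩
        (a * c + b * d) - (a * d + b * c)      ∎

      ι : ℤ → Carrier
      ι (+ n)    = ν n
      ι -[1+ n ] = - ν (suc n)

      ι-⊝ : ∀ m n → ι (m ⊝ n) ≈ ν m - ν n
      ι-⊝ m       zero    = sym (trans (+-congˡ (trans (-‿cong (numeral≈×1 0)) ε⁻¹≈ε)) (+-identityʳ _))
      ι-⊝ zero    (suc n) = sym (trans (+-congʳ (numeral≈×1 0)) (+-identityˡ _))
      ι-⊝ (suc m) (suc n) = begin
        ι (suc m ⊝ suc n)                    ≡⟨ ≡.cong ι (ℤ.[1+m]⊖[1+n]≡m⊖n m n) ⟩
        ι (m ⊝ n)                            ≈⟨ ι-⊝ m n ⟩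
        ν m - ν n                            ≈⟨ +-identityˡ _ ⟨
        0# + (ν m - ν n)                     ≈⟨ +-congʳ (-‿inverseʳ (ν 1)) ⟨
        (ν 1 - ν 1) + (ν m - ν n)            ≈⟨ [a-b]+[c-d] (ν 1) (ν 1) (ν m) (ν n) ⟩
        (ν 1 + ν m) - (ν 1 + ν n)            ≈⟨ +-cong (ν-homo-+ 1 m) (-‿cong (ν-homo-+ 1 n)) ⟨
        ν (suc m) - ν (suc n)                ∎

      pos neg : ℤ → ℕ
      pos (+ n)    = n
      pos -[1+ n ] = 0
      neg (+ n)    = 0
      neg -[1+ n ] = suc n

      pos⊝neg : ∀ z → pos z ⊝ neg z ≡.≡ z
      pos⊝neg (+ n)    = ≡.refl
      pos⊝neg -[1+ n ] = ≡.refl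

      ι-via-parts : ∀ z → ι z ≈ ν (pos z) - ν (neg z)
      ι-via-parts z = trans (reflexive (≡.cong ι (≡.sym (pos⊝neg z)))) (ι-⊝ (pos z) (neg z))

      ι-+ : ∀ z w → ι (z ℤ.+ w) ≈ ι z + ι w
      ι-+ z w = begin
        ι (z ℤ.+ w)                                  ≡⟨ ≡.cong₂ (λ x y → ι (x ℤ.+ y)) (pos⊝neg z) (pos⊝neg w) ⟨
        ι ((a ⊝ b) ℤ.+ (c ⊝ d))                      ≡⟨ ≡.cong ι (⊝-+-⊝ a b c d) ⟩
        ι ((a ℕ.+ c) ⊝ (b ℕ.+ d))                    ≈⟨ ι-⊝ (a ℕ.+ c) (b ℕ.+ d) ⟩
        ν (a ℕ.+ c) - ν (b ℕ.+ d)                    ≈⟨ +-cong (ν-homo-+ a c) (-‿cong (ν-homo-+ b d)) ⟩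
        (ν a + ν c) - (ν b + ν d)                    ≈⟨ [a-b]+[c-d] (ν a) (ν b) (ν c) (ν d) ⟨
        (ν a - ν b) + (ν c - ν d)                    ≈⟨ +-cong (ι-via-parts z) (ι-via-parts w) ⟨
        ι z + ι w                                    ∎
        where a = pos z; b = neg z; c = pos w; d = neg w

      ι-* : ∀ z w → ι (z ℤ.* w) ≈ ι z * ι w
      ι-* z w = begin
        ι (z ℤ.* w)                                  ≡⟨ ≡.cong₂ (λ x y → ι (x ℤ.* y)) (pos⊝neg z) (pos⊝neg w) ⟨
        ι ((a ⊝ b) ℤ.* (c ⊝ d))                      ≡⟨ ≡.cong ι (⊝-*-⊝ a b c d) ⟩
        ι ((a ℕ.* c ℕ.+ b ℕ.* d) ⊝ (a ℕ.* d ℕ.+ b ℕ.* c))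
          ≈⟨ ι-⊝ (a ℕ.* c ℕ.+ b ℕ.* d) (a ℕ.* d ℕ.+ b ℕ.* c) ⟩
        ν (a ℕ.* c ℕ.+ b ℕ.* d) - ν (a ℕ.* d ℕ.+ b ℕ.* c)
          ≈⟨ +-cong (ν-homo-*-+-* a c b d) (-‿cong (ν-homo-*-+-* a d b c)) ⟩
        (ν a * ν c + ν b * ν d) - (ν a * ν d + ν b * ν c) ≈⟨ [a-b]*[c-d] (ν a) (ν b) (ν c) (ν d) ⟨
        (ν a - ν b) * (ν c - ν d)                    ≈⟨ *-cong (ι-via-parts z) (ι-via-parts w) ⟨
        ι z * ι w                                    ∎
        where
        a = pos z; b = neg z; c = pos w; d = neg w
        ν-homo-*-+-* : ∀ m n k l → ν (m ℕ.* n ℕ.+ k ℕ.* l) ≈ ν m * ν n + ν k * ν l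
        ν-homo-*-+-* m n k l = trans (ν-homo-+ (m ℕ.* n) (k ℕ.* l)) (+-cong (ν-homo-* m n) (ν-homo-* k l))

      ι-neg : ∀ z → ι (ℤ.- z) ≈ - ι z
      ι-neg z = begin
        ι (ℤ.- z)                            ≡⟨ ≡.cong (λ x → ι (ℤ.- x)) (pos⊝neg z) ⟨
        ι (ℤ.- (pos z ⊝ neg z))              ≡⟨ ≡.cong ι (ℤ.⊖-swap (neg z) (pos z)) ⟨
        ι (neg z ⊝ pos z)                    ≈⟨ ι-⊝ (neg z) (pos z) ⟩
        ν (neg z) - ν (pos z)                ≈⟨ ⁻¹-anti-homo‿- (ν (pos z)) (ν (neg z)) ⟨
        - (ν (pos z) - ν (neg z))            ≈⟨ -‿cong (ι-via-parts z) ⟨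
        - ι z                                ∎

      ι-morphism : ℤ.+-*-rawRing ACR.-Raw-AlmostCommutative⟶ ACR.fromCommutativeRing R
      ι-morphism = record
        { ⟦_⟧ = ι ; +-homo = ι-+ ; *-homo = ι-* ; -‿homo = ι-neg
        ; 0-homo = numeral≈×1 0 ; 1-homo = trans (numeral≈×1 1) (+-identityʳ 1#) }

      ι-equal? : ∀ z w → Maybe (ι z ≈ ι w)
      ι-equal? z w with z ℤ.≟ w
      ... | yes z≡w = just (reflexive (≡.cong ι z≡w))
      ... | no _    = nothing

    open import Algebra.Solver.Ring ℤ.+-*-rawRing (ACR.fromCommutativeRing R) ι-morphism ι-equal? public
      using (solve; _:=_; _:+_; _:*_; :-_; _:-_; _:^_; con)

module CommutativeMonoidSums {a ℓ} (M : CommutativeMonoid a ℓ) where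

  open CommutativeMonoid M renaming
    (_∙_ to _+_; ∙-cong to +-cong; ∙-congˡ to +-congˡ; ∙-congʳ to +-congʳ; ε to 0#;
     identityˡ to +-identityˡ; identityʳ to +-identityʳ; assoc to +-assoc; comm to +-comm)
  open import Algebra.Properties.CommutativeMonoid.Sum M as Sums using (sum; sum-syntax; sum-cong-≋; sum-replicate-zero)
  open import Relation.Binary.Reasoning.Setoid setoid

  ∑-zero : ∀ {n} (f : Vector Carrier n) → (∀ i → f i ≈ 0#) → sum f ≈ 0#
  ∑-zero {n} f f≈0 = trans (sum-cong-≋ f≈0) (sum-replicate-zero n)

  ∑-single : ∀ {n} (f : Vector Carrier n) i → (∀ j → j ≢ i → f j ≈ 0#) → sum f ≈ f i
  ∑-single f zero    f≈0 = trans (+-congˡ (∑-zero (f ∘ suc) (λ j → f≈0 (suc j) λ ()))) (+-identityʳ (f zero))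
  ∑-single f (suc i) f≈0 = begin
    f zero + sum (f ∘ suc)     ≈⟨ +-cong (f≈0 zero λ ()) (∑-single (f ∘ suc) i (λ j j≢i → f≈0 (suc j) (j≢i ∘ Finₚ.suc-injective))) ⟩
    0# + f (suc i)             ≈⟨ +-identityˡ (f (suc i)) ⟩
    f (suc i)                  ∎

  ∑-pair : ∀ {n} (f : Vector Carrier n) i k → i ≢ k → (∀ j → j ≢ i → j ≢ k → f j ≈ 0#) → sum f ≈ f i + f k
  ∑-pair f zero    zero    i≢k f≈0 = contradiction ≡.refl i≢k
  ∑-pair f zero    (suc k) i≢k f≈0 =
    +-congˡ (∑-single (f ∘ suc) k (λ j j≢k → f≈0 (suc j) (λ ()) (j≢k ∘ Finₚ.suc-injective)))
  ∑-pair f (suc i) zero    i≢k f≈0 =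
    trans (+-congˡ (∑-single (f ∘ suc) i (λ j j≢i → f≈0 (suc j) (j≢i ∘ Finₚ.suc-injective) (λ ())))) (+-comm _ _)
  ∑-pair f (suc i) (suc k) i≢k f≈0 = begin
    f zero + sum (f ∘ suc)     ≈⟨ +-cong (f≈0 zero (λ ()) (λ ())) (∑-pair (f ∘ suc) i k (i≢k ∘ cong suc) f≈0∘suc) ⟩
    0# + (f (suc i) + f (suc k)) ≈⟨ +-identityˡ _ ⟩
    f (suc i) + f (suc k)      ∎
    where
    f≈0∘suc : ∀ j → j ≢ i → j ≢ k → f (suc j) ≈ 0#
    f≈0∘suc j j≢i j≢k = f≈0 (suc j) (j≢i ∘ Finₚ.suc-injective) (j≢k ∘ Finₚ.suc-injective)

  ∑-snoc : ∀ n (f : ℕ → Carrier) → ∑[ i < suc n ] f (toℕ i) ≈ ∑[ i < n ] f (toℕ i) + f n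
  ∑-snoc zero    f = trans (+-identityʳ (f 0)) (sym (+-identityˡ (f 0)))
  ∑-snoc (suc n) f = trans (+-congˡ (∑-snoc n (f ∘ suc))) (sym (+-assoc _ _ _))

  private
    ∑-rotate : ∀ n (f : ℕ → Carrier) → f n ≈ f 0 → ∑[ i < n ] f (suc (toℕ i)) ≈ ∑[ i < n ] f (toℕ i)
    ∑-rotate zero    f _       = refl
    ∑-rotate (suc n) f fn≈f0 = begin
      ∑[ i < suc n ] f (suc (toℕ i))   ≈⟨ ∑-snoc n (f ∘ suc) ⟩
      ∑[ i < n ] f (suc (toℕ i)) + f (suc n) ≈⟨ +-congˡ fn≈f0 ⟩
      ∑[ i < n ] f (suc (toℕ i)) + f 0 ≈⟨ +-comm _ _ ⟩
      f 0 + ∑[ i < n ] f (suc (toℕ i)) ∎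

  ∑-shift-periodic : ∀ n (f : ℕ → Carrier) → (∀ i → f (i ℕ.+ n) ≈ f i) →
                     ∀ k → ∑[ i < n ] f (toℕ i ℕ.+ k) ≈ ∑[ i < n ] f (toℕ i)
  ∑-shift-periodic n f periodic zero    = reflexive (Sums.sum-cong-≗ {n} (λ i → cong f (ℕ.+-identityʳ (toℕ i))))
  ∑-shift-periodic n f periodic (suc k) = begin
    ∑[ i < n ] f (toℕ i ℕ.+ suc k)     ≡⟨ Sums.sum-cong-≗ {n} (λ i → cong f (ℕ.+-suc (toℕ i) k)) ⟩
    ∑[ i < n ] f (suc (toℕ i ℕ.+ k))   ≈⟨ ∑-rotate n (λ i → f (i ℕ.+ k)) (trans (reflexive (cong f (ℕ.+-comm n k))) (periodic k)) ⟩
    ∑[ i < n ] f (toℕ i ℕ.+ k)         ≈⟨ ∑-shift-periodic n f periodic k ⟩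
    ∑[ i < n ] f (toℕ i)               ∎

module AbelianGroupSums {a ℓ} (G : AbelianGroup a ℓ) where

  open AbelianGroup G renaming
    (_∙_ to _+_; ∙-cong to +-cong; ∙-congˡ to +-congˡ; ∙-congʳ to +-congʳ; ε to 0#;
     identityˡ to +-identityˡ; inverseˡ to -‿inverseˡ; inverseʳ to -‿inverseʳ; assoc to +-assoc; comm to +-comm)
  open import Algebra.Properties.Monoid.Sum monoid using (sum-syntax)
  open import Relation.Binary.Reasoning.Setoid setoid

  ∑-telescope : ∀ n (g : ℕ → Carrier) → ∑[ i < n ] (g (suc (toℕ i)) - g (toℕ i)) ≈ g n - g 0
  ∑-telescope zero    g = sym (-‿inverseʳ (g 0))
  ∑-telescope (suc n) g = begin
    (g 1 - g 0) + ∑[ i < n ] (g (suc (suc (toℕ i))) - g (suc (toℕ i)))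
                                          ≈⟨ +-congˡ (∑-telescope n (g ∘ suc)) ⟩
    (g 1 - g 0) + (g (suc n) - g 1)       ≈⟨ +-comm _ _ ⟩
    (g (suc n) - g 1) + (g 1 - g 0)       ≈⟨ +-assoc _ _ _ ⟩
    g (suc n) + (g 1 ⁻¹ + (g 1 - g 0))    ≈⟨ +-congˡ (+-assoc _ _ _) ⟨
    g (suc n) + ((g 1 ⁻¹ + g 1) - g 0)    ≈⟨ +-congˡ (+-congʳ (-‿inverseˡ (g 1))) ⟩
    g (suc n) + (0# - g 0)                ≈⟨ +-congˡ (+-identityˡ _) ⟩
    g (suc n) - g 0                       ∎

module Residues (p : ℕ) .{{_ : NonZero p}} where

  open ≡-Reasoning

  ⟦_⟧ : ℕ → Fin p
  ⟦ n ⟧ = n mod p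

  -_ : Fin p → Fin p
  - x = ⟦ p ∸ toℕ x ⟧

  infixl 6 _-_
  _-_ : Fin p → Fin p → Fin p
  x - y = x ⊕ (- y)

  toℕ-⟦⟧ : ∀ n → toℕ ⟦ n ⟧ ≡ n % p
  toℕ-⟦⟧ n = Finₚ.toℕ-fromℕ< _

  ⟦toℕ⟧ : ∀ x → ⟦ toℕ x ⟧ ≡ x
  ⟦toℕ⟧ x = Finₚ.toℕ-injective (≡.trans (toℕ-⟦⟧ (toℕ x)) (m<n⇒m%n≡m (Finₚ.toℕ<n x)))

  ⟦⟧-cong-% : ∀ {m n} → m % p ≡ n % p → ⟦ m ⟧ ≡ ⟦ n ⟧
  ⟦⟧-cong-% {m} {n} eq = Finₚ.toℕ-injective (≡.trans (toℕ-⟦⟧ m) (≡.trans eq (≡.sym (toℕ-⟦⟧ n))))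

  ⟦⟧-+ : ∀ m n → ⟦ m ⟧ ⊕ ⟦ n ⟧ ≡ ⟦ m ℕ.+ n ⟧
  ⟦⟧-+ m n = ⟦⟧-cong-% (≡.trans (cong₂ (λ a b → (a ℕ.+ b) % p) (toℕ-⟦⟧ m) (toℕ-⟦⟧ n)) (≡.sym (%-distribˡ-+ m n p)))

  ⟦⟧-* : ∀ m n → ⟦ m ⟧ ⊗ ⟦ n ⟧ ≡ ⟦ m ℕ.* n ⟧
  ⟦⟧-* m n = ⟦⟧-cong-% (≡.trans (cong₂ (λ a b → (a ℕ.* b) % p) (toℕ-⟦⟧ m) (toℕ-⟦⟧ n)) (≡.sym (%-distribˡ-* m n p)))

  ⊖≡- : ∀ x y → x ⊖ y ≡ x - y
  ⊖≡- x y = ≡.trans (≡.sym (⟦⟧-+ (toℕ x) (p ∸ toℕ y))) (cong (_⊕ (- y)) (⟦toℕ⟧ x))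

  ⟦p⟧ : ⟦ p ⟧ ≡ 𝟘
  ⟦p⟧ = ⟦⟧-cong-% (≡.trans (n%n≡0 p) (≡.sym (m<n⇒m%n≡m (ℕ.>-nonZero⁻¹ p))))

  private
    ⊕-assoc : ∀ x y z → (x ⊕ y) ⊕ z ≡ x ⊕ (y ⊕ z)
    ⊕-assoc x y z = begin
      ⟦ a ℕ.+ b ⟧ ⊕ z         ≡⟨ cong (⟦ a ℕ.+ b ⟧ ⊕_) (⟦toℕ⟧ z) ⟨
      ⟦ a ℕ.+ b ⟧ ⊕ ⟦ c ⟧     ≡⟨ ⟦⟧-+ (a ℕ.+ b) c ⟩
      ⟦ a ℕ.+ b ℕ.+ c ⟧       ≡⟨ cong ⟦_⟧ (ℕ.+-assoc a b c) ⟩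
      ⟦ a ℕ.+ (b ℕ.+ c) ⟧     ≡⟨ ⟦⟧-+ a (b ℕ.+ c) ⟨
      ⟦ a ⟧ ⊕ ⟦ b ℕ.+ c ⟧     ≡⟨ cong (_⊕ ⟦ b ℕ.+ c ⟧) (⟦toℕ⟧ x) ⟩
      x ⊕ (y ⊕ z)             ∎
      where a = toℕ x; b = toℕ y; c = toℕ z

    ⊗-assoc : ∀ x y z → (x ⊗ y) ⊗ z ≡ x ⊗ (y ⊗ z)
    ⊗-assoc x y z = begin
      ⟦ a ℕ.* b ⟧ ⊗ z         ≡⟨ cong (⟦ a ℕ.* b ⟧ ⊗_) (⟦toℕ⟧ z) ⟨
      ⟦ a ℕ.* b ⟧ ⊗ ⟦ c ⟧     ≡⟨ ⟦⟧-* (a ℕ.* b) c ⟩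
      ⟦ a ℕ.* b ℕ.* c ⟧       ≡⟨ cong ⟦_⟧ (ℕ.*-assoc a b c) ⟩
      ⟦ a ℕ.* (b ℕ.* c) ⟧     ≡⟨ ⟦⟧-* a (b ℕ.* c) ⟨
      ⟦ a ⟧ ⊗ ⟦ b ℕ.* c ⟧     ≡⟨ cong (_⊗ ⟦ b ℕ.* c ⟧) (⟦toℕ⟧ x) ⟩
      x ⊗ (y ⊗ z)             ∎
      where a = toℕ x; b = toℕ y; c = toℕ z

    ⊗-distribˡ-⊕ : ∀ x y z → x ⊗ (y ⊕ z) ≡ (x ⊗ y) ⊕ (x ⊗ z)
    ⊗-distribˡ-⊕ x y z = begin
      x ⊗ ⟦ b ℕ.+ c ⟧                 ≡⟨ cong (_⊗ ⟦ b ℕ.+ c ⟧) (⟦toℕ⟧ x) ⟨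
      ⟦ a ⟧ ⊗ ⟦ b ℕ.+ c ⟧             ≡⟨ ⟦⟧-* a (b ℕ.+ c) ⟩
      ⟦ a ℕ.* (b ℕ.+ c) ⟧             ≡⟨ cong ⟦_⟧ (ℕ.*-distribˡ-+ a b c) ⟩
      ⟦ a ℕ.* b ℕ.+ a ℕ.* c ⟧         ≡⟨ ⟦⟧-+ (a ℕ.* b) (a ℕ.* c) ⟨
      (x ⊗ y) ⊕ (x ⊗ z)               ∎
      where a = toℕ x; b = toℕ y; c = toℕ z

    ⊕-identityˡ : ∀ x → 𝟘 ⊕ x ≡ x
    ⊕-identityˡ x = ≡.trans (cong (𝟘 ⊕_) (≡.sym (⟦toℕ⟧ x))) (≡.trans (⟦⟧-+ 0 (toℕ x)) (⟦toℕ⟧ x))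

    ⊗-identityˡ : ∀ x → 𝟙 ⊗ x ≡ x
    ⊗-identityˡ x = ≡.trans (cong (𝟙 ⊗_) (≡.sym (⟦toℕ⟧ x)))
                      (≡.trans (⟦⟧-* 1 (toℕ x)) (≡.trans (cong ⟦_⟧ (ℕ.*-identityˡ (toℕ x))) (⟦toℕ⟧ x)))

    ⊕-inverseˡ : ∀ x → (- x) ⊕ x ≡ 𝟘
    ⊕-inverseˡ x = begin
      ⟦ p ∸ toℕ x ⟧ ⊕ x               ≡⟨ cong (⟦ p ∸ toℕ x ⟧ ⊕_) (⟦toℕ⟧ x) ⟨
      ⟦ p ∸ toℕ x ⟧ ⊕ ⟦ toℕ x ⟧       ≡⟨ ⟦⟧-+ (p ∸ toℕ x) (toℕ x) ⟩
      ⟦ p ∸ toℕ x ℕ.+ toℕ x ⟧         ≡⟨ cong ⟦_⟧ (ℕ.m∸n+n≡m (ℕ.<⇒≤ (Finₚ.toℕ<n x))) ⟩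
      ⟦ p ⟧                           ≡⟨ ⟦p⟧ ⟩
      𝟘                               ∎

    ⊕-comm : ∀ x y → x ⊕ y ≡ y ⊕ x
    ⊕-comm x y = cong ⟦_⟧ (ℕ.+-comm (toℕ x) (toℕ y))

    ⊗-comm : ∀ x y → x ⊗ y ≡ y ⊗ x
    ⊗-comm x y = cong ⟦_⟧ (ℕ.*-comm (toℕ x) (toℕ y))

  isCommutativeRing : IsCommutativeRing _≡_ _⊕_ _⊗_ -_ 𝟘 𝟙
  isCommutativeRing = record
    { isRing = record
      { +-isAbelianGroup = record
        { isGroup = record
          { isMonoid = record
            { isSemigroup = record { isMagma = ≡.isMagma _⊕_ ; assoc = ⊕-assoc }
            ; identity = comm∧idˡ⇒id ⊕-comm ⊕-identityˡ }
          ; inverse = comm∧invˡ⇒inv ⊕-comm ⊕-inverseˡ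
          ; ⁻¹-cong = cong (-_) }
        ; comm = ⊕-comm }
      ; *-cong = cong₂ _⊗_
      ; *-assoc = ⊗-assoc
      ; *-identity = comm∧idˡ⇒id ⊗-comm ⊗-identityˡ
      ; distrib = comm∧distrˡ⇒distr (cong₂ _⊕_) ⊗-comm ⊗-distribˡ-⊕ }
    ; *-comm = ⊗-comm }

  commutativeRing : CommutativeRing 0ℓ 0ℓ
  commutativeRing = record { isCommutativeRing = isCommutativeRing }

  module 𝔽 = CommutativeRing commutativeRing
  module Sums = SemiringSumProperties 𝔽.semiring
  open Sums public using (sum-syntax; sum⁺-syntax)
  module Mult = MultProperties 𝔽.semiring

  ×≡⟦⟧⊗ : ∀ n x → n Mult.× x ≡ ⟦ n ⟧ ⊗ x
  ×≡⟦⟧⊗ zero    x = ≡.sym (𝔽.zeroˡ x)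
  ×≡⟦⟧⊗ (suc n) x = begin
    x ⊕ n Mult.× x          ≡⟨ cong₂ _⊕_ (≡.sym (𝔽.*-identityˡ x)) (×≡⟦⟧⊗ n x) ⟩
    𝟙 ⊗ x ⊕ ⟦ n ⟧ ⊗ x       ≡⟨ 𝔽.distribʳ x 𝟙 ⟦ n ⟧ ⟨
    (𝟙 ⊕ ⟦ n ⟧) ⊗ x         ≡⟨ cong (_⊗ x) (⟦⟧-+ 1 n) ⟩
    ⟦ suc n ⟧ ⊗ x           ∎

  ⟦⟧≡×𝟙 : ∀ n → ⟦ n ⟧ ≡ n Mult.× 𝟙
  ⟦⟧≡×𝟙 n = ≡.trans (≡.sym (𝔽.*-identityʳ ⟦ n ⟧)) (≡.sym (×≡⟦⟧⊗ n 𝟙))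

  open IntegerCoefficientRingSolver.Numerals commutativeRing ⟦_⟧ ⟦⟧≡×𝟙 public
    using (solve; _:=_; _:+_; _:*_; :-_; _:-_; _:^_; con)

  cubic : Fin p → Fin p
  cubic x = x ^ 3 - x - 𝟙

  ⊖-cubic : ∀ x → x ^ 3 ⊖ x ⊖ 𝟙 ≡ cubic x
  ⊖-cubic x = ≡.trans (⊖≡- (x ^ 3 ⊖ x) 𝟙) (cong (_- 𝟙) (⊖≡- (x ^ 3) x))

  IsCubicRoot⇒cubic≡𝟘 : ∀ x → IsCubicRoot x → cubic x ≡ 𝟘
  IsCubicRoot⇒cubic≡𝟘 x root = ≡.trans (≡.sym (⊖-cubic x)) root

  cubic≡𝟘⇒IsCubicRoot : ∀ x → cubic x ≡ 𝟘 → IsCubicRoot x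
  cubic≡𝟘⇒IsCubicRoot x root = ≡.trans (⊖-cubic x) root

-- The prime is written suc N, so that p - 1, the order of the multiplicative group, computes to N.
module PrimeField (N : ℕ) (p-prime : Prime (suc N)) where

  open Residues (suc N) public
  open import Data.Nat.Combinatorics using (_C_; nCk≡n!/k![n-k]!; k![n∸k]!∣n!; nCn≡1; nC1≡n; nCk≡nC[n∸k])
  open ≡-Reasoning
  private
    module G = GroupProperties 𝔽.+-group
    module R = RingProperties 𝔽.ring
    module CS = CommutativeSemigroupProperties 𝔽.*-commutativeSemigroup
    module Binomial = BinomialProperties 𝔽.commutativeSemiring
    open import Algebra.Properties.Semiring.Exp 𝔽.semiring using () renaming (_^_ to _^ₛ_)
  open CommutativeMonoidSums 𝔽.+-commutativeMonoid
  open AbelianGroupSums 𝔽.+-abelianGroup using (∑-telescope)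

  infix 4 _≟_
  _≟_ : DecidableEquality (Fin (suc N))
  _≟_ = Finₚ._≟_

  0<N : 0 < N
  0<N = ℕ.s≤s⁻¹ (ℕ.nonTrivial⇒n>1 (suc N) {{prime⇒nonTrivial p-prime}})

  ⟦⟧≡𝟘⇒∣ : ∀ n → ⟦ n ⟧ ≡ 𝟘 → suc N ∣ n
  ⟦⟧≡𝟘⇒∣ n eq = m%n≡0⇒n∣m n (suc N) (≡.trans (≡.sym (toℕ-⟦⟧ n)) (cong toℕ eq))

  ⟦⟧≢𝟘 : ∀ {n} → 0 < n → n ≤ N → ⟦ n ⟧ ≢ 𝟘
  ⟦⟧≢𝟘 {suc n} _ n<p eq = ℕ.<⇒≱ (s≤s n<p) (∣⇒≤ (⟦⟧≡𝟘⇒∣ (suc n) eq))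

  𝟙≢𝟘 : 𝟙 ≢ 𝟘
  𝟙≢𝟘 = ⟦⟧≢𝟘 (s≤s z≤n) 0<N

  toℕ-𝟙 : toℕ 𝟙 ≡ 1
  toℕ-𝟙 = ≡.trans (toℕ-⟦⟧ 1) (m<n⇒m%n≡m (s≤s 0<N))

  2≤toℕ⇒≢𝟘 : ∀ {x : Fin (suc N)} → 2 ≤ toℕ x → x ≢ 𝟘
  2≤toℕ⇒≢𝟘 2≤x ≡.refl = contradiction 2≤x λ ()

  2≤toℕ⇒≢𝟙 : ∀ {x : Fin (suc N)} → 2 ≤ toℕ x → x ≢ 𝟙
  2≤toℕ⇒≢𝟙 2≤x ≡.refl = contradiction (≡.subst (2 ≤_) toℕ-𝟙 2≤x) λ { (s≤s ()) }

  ≢𝟘∧≢𝟙⇒2≤toℕ : ∀ {x : Fin (suc N)} → x ≢ 𝟘 → x ≢ 𝟙 → 2 ≤ toℕ x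
  ≢𝟘∧≢𝟙⇒2≤toℕ {x} x≢0 x≢1 with toℕ x in eq
  ... | zero        = contradiction (Finₚ.toℕ-injective eq) x≢0
  ... | suc zero    = contradiction (Finₚ.toℕ-injective (≡.trans eq (≡.sym toℕ-𝟙))) x≢1
  ... | suc (suc _) = s≤s (s≤s z≤n)

  m<p∧p∣m⇒m≡0 : ∀ {m} → m ≤ N → suc N ∣ m → m ≡ 0
  m<p∧p∣m⇒m≡0 {zero}  _   _   = ≡.refl
  m<p∧p∣m⇒m≡0 {suc m} m≤N p∣m = contradiction (∣⇒≤ p∣m) (ℕ.<⇒≱ (s≤s m≤N))

  ∣toℕ⇒≡𝟘 : ∀ x → suc N ∣ toℕ x → x ≡ 𝟘
  ∣toℕ⇒≡𝟘 x p∣x = Finₚ.toℕ-injective (m<p∧p∣m⇒m≡0 (ℕ.s≤s⁻¹ (Finₚ.toℕ<n x)) p∣x)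

  ⊗-integral : ∀ x y → x ⊗ y ≡ 𝟘 → x ≡ 𝟘 ⊎ y ≡ 𝟘
  ⊗-integral x y xy≡0 = Sum.map (∣toℕ⇒≡𝟘 x) (∣toℕ⇒≡𝟘 y)
    (euclidsLemma (toℕ x) (toℕ y) p-prime (⟦⟧≡𝟘⇒∣ (toℕ x ℕ.* toℕ y) xy≡0))

  ⊗-≢𝟘 : ∀ {x y} → x ≢ 𝟘 → y ≢ 𝟘 → x ⊗ y ≢ 𝟘
  ⊗-≢𝟘 x≢0 y≢0 xy≡0 = Sum.[ x≢0 , y≢0 ]′ (⊗-integral _ _ xy≡0)

  ⊗-cancelˡ : ∀ {x} y z → x ≢ 𝟘 → x ⊗ y ≡ x ⊗ z → y ≡ z
  ⊗-cancelˡ {x} y z x≢0 xy≡xz = Sum.[ (λ x≡0 → contradiction x≡0 x≢0) , G.x∙y⁻¹≈ε⇒x≈y y z ]′ (⊗-integral x (y - z) x[y-z]≡0)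
    where
    x[y-z]≡0 : x ⊗ (y - z) ≡ 𝟘
    x[y-z]≡0 = ≡.trans (R.x[y-z]≈xy-xz x y z) (G.x≈y⇒x∙y⁻¹≈ε xy≡xz)

  ⊗-cancelʳ : ∀ {x} y z → x ≢ 𝟘 → y ⊗ x ≡ z ⊗ x → y ≡ z
  ⊗-cancelʳ {x} y z x≢0 yx≡zx = ⊗-cancelˡ y z x≢0 (≡.trans (𝔽.*-comm x y) (≡.trans yx≡zx (𝔽.*-comm z x)))

  ^-homo-⊗ : ∀ x m n → x ^ (m ℕ.+ n) ≡ x ^ m ⊗ x ^ n
  ^-homo-⊗ x zero    n = ≡.sym (𝔽.*-identityˡ (x ^ n))
  ^-homo-⊗ x (suc m) n = ≡.trans (cong (x ⊗_) (^-homo-⊗ x m n)) (≡.sym (𝔽.*-assoc x (x ^ m) (x ^ n)))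

  ^-assocʳ : ∀ x m n → (x ^ m) ^ n ≡ x ^ (m ℕ.* n)
  ^-assocʳ x m zero    = cong (x ^_) (≡.sym (ℕ.*-zeroʳ m))
  ^-assocʳ x m (suc n) = begin
    x ^ m ⊗ (x ^ m) ^ n     ≡⟨ cong (x ^ m ⊗_) (^-assocʳ x m n) ⟩
    x ^ m ⊗ x ^ (m ℕ.* n)   ≡⟨ ^-homo-⊗ x m (m ℕ.* n) ⟨
    x ^ (m ℕ.+ m ℕ.* n)     ≡⟨ cong (x ^_) (ℕ.*-suc m n) ⟨
    x ^ (m ℕ.* suc n)       ∎

  ^-distrib-⊗ : ∀ x y n → (x ⊗ y) ^ n ≡ x ^ n ⊗ y ^ n
  ^-distrib-⊗ x y zero    = ≡.sym (𝔽.*-identityˡ 𝟙)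
  ^-distrib-⊗ x y (suc n) = ≡.trans (cong ((x ⊗ y) ⊗_) (^-distrib-⊗ x y n)) (CS.interchange x y (x ^ n) (y ^ n))

  𝟙^n≡𝟙 : ∀ n → 𝟙 ^ n ≡ 𝟙 {suc N}
  𝟙^n≡𝟙 zero    = ≡.refl
  𝟙^n≡𝟙 (suc n) = ≡.trans (𝔽.*-identityˡ (𝟙 ^ n)) (𝟙^n≡𝟙 n)

  𝟘^n≡𝟘 : ∀ {n} → 0 < n → 𝟘 ^ n ≡ 𝟘 {suc N}
  𝟘^n≡𝟘 {suc n} _ = 𝔽.zeroˡ (𝟘 ^ n)

  ^-≢𝟘 : ∀ {x} n → x ≢ 𝟘 → x ^ n ≢ 𝟘
  ^-≢𝟘 zero    x≢0 = 𝟙≢𝟘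
  ^-≢𝟘 (suc n) x≢0 = ⊗-≢𝟘 x≢0 (^-≢𝟘 n x≢0)

  binomial-𝟙 : ∀ x n → (x ⊕ 𝟙) ^ n ≡ ∑[ k ≤ n ] (⟦ n C toℕ k ⟧ ⊗ x ^ toℕ k)
  binomial-𝟙 x n = begin
    (x ⊕ 𝟙) ^ n                    ≡⟨ ^≡^ₛ (x ⊕ 𝟙) n ⟩
    (x ⊕ 𝟙) ^ₛ n                   ≡⟨ Binomial.theorem n x 𝟙 ⟩
    Binomial.binomialExpansion x 𝟙 n ≡⟨ Sums.sum-cong-≗ {suc n} term ⟩
    ∑[ k ≤ n ] (⟦ n C toℕ k ⟧ ⊗ x ^ toℕ k) ∎
    where
    ^≡^ₛ : ∀ y m → y ^ m ≡ y ^ₛ m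
    ^≡^ₛ y zero    = ≡.refl
    ^≡^ₛ y (suc m) = cong (y ⊗_) (^≡^ₛ y m)
    term : ∀ k → (n C toℕ k) Mult.× (x ^ₛ toℕ k ⊗ 𝟙 ^ₛ (n ∸ toℕ k)) ≡ ⟦ n C toℕ k ⟧ ⊗ x ^ toℕ k
    term k = begin
      (n C toℕ k) Mult.× (x ^ₛ toℕ k ⊗ 𝟙 ^ₛ (n ∸ toℕ k)) ≡⟨ ×≡⟦⟧⊗ (n C toℕ k) _ ⟩
      ⟦ n C toℕ k ⟧ ⊗ (x ^ₛ toℕ k ⊗ 𝟙 ^ₛ (n ∸ toℕ k)) ≡⟨ cong (λ y → ⟦ n C toℕ k ⟧ ⊗ (y ⊗ 𝟙 ^ₛ (n ∸ toℕ k))) (≡.sym (^≡^ₛ x (toℕ k))) ⟩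
      ⟦ n C toℕ k ⟧ ⊗ (x ^ toℕ k ⊗ 𝟙 ^ₛ (n ∸ toℕ k))   ≡⟨ cong (λ y → ⟦ n C toℕ k ⟧ ⊗ (x ^ toℕ k ⊗ y)) (≡.trans (≡.sym (^≡^ₛ 𝟙 (n ∸ toℕ k))) (𝟙^n≡𝟙 (n ∸ toℕ k))) ⟩
      ⟦ n C toℕ k ⟧ ⊗ (x ^ toℕ k ⊗ 𝟙)                 ≡⟨ cong (⟦ n C toℕ k ⟧ ⊗_) (𝔽.*-identityʳ _) ⟩
      ⟦ n C toℕ k ⟧ ⊗ x ^ toℕ k                        ∎

  binomial-𝟙-init-last : ∀ x n → (x ⊕ 𝟙) ^ suc n ≡ ∑[ k ≤ n ] (⟦ suc n C toℕ k ⟧ ⊗ x ^ toℕ k) ⊕ x ^ suc n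
  binomial-𝟙-init-last x n = begin
    (x ⊕ 𝟙) ^ suc n                                     ≡⟨ binomial-𝟙 x (suc n) ⟩
    ∑[ k ≤ suc n ] term k                               ≡⟨ Sums.sum-init-last term ⟩
    ∑[ k ≤ n ] term (Fin.inject₁ k) ⊕ term (Fin.fromℕ (suc n)) ≡⟨ cong₂ _⊕_ (Sums.sum-cong-≗ {suc n} init-term) last-term ⟩
    ∑[ k ≤ n ] (⟦ suc n C toℕ k ⟧ ⊗ x ^ toℕ k) ⊕ x ^ suc n ∎
    where
    term : Fin (suc (suc n)) → Fin (suc N)
    term k = ⟦ suc n C toℕ k ⟧ ⊗ x ^ toℕ k
    init-term : ∀ k → term (Fin.inject₁ k) ≡ ⟦ suc n C toℕ k ⟧ ⊗ x ^ toℕ k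
    init-term k = cong (λ j → ⟦ suc n C j ⟧ ⊗ x ^ j) (Finₚ.toℕ-inject₁ k)
    last-term : term (Fin.fromℕ (suc n)) ≡ x ^ suc n
    last-term = begin
      term (Fin.fromℕ (suc n))                ≡⟨ cong (λ j → ⟦ suc n C j ⟧ ⊗ x ^ j) (Finₚ.toℕ-fromℕ (suc n)) ⟩
      ⟦ suc n C suc n ⟧ ⊗ x ^ suc n           ≡⟨ cong (λ c → ⟦ c ⟧ ⊗ x ^ suc n) (nCn≡1 (suc n)) ⟩
      𝟙 ⊗ x ^ suc n                           ≡⟨ 𝔽.*-identityˡ (x ^ suc n) ⟩
      x ^ suc n                               ∎

  ⟦m!⟧≢𝟘 : ∀ {m} → m ≤ N → ⟦ m ! ⟧ ≢ 𝟘
  ⟦m!⟧≢𝟘 {zero}  _    = 𝟙≢𝟘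
  ⟦m!⟧≢𝟘 {suc m} m≤N = ⊗-≢𝟘 (⟦⟧≢𝟘 (s≤s z≤n) m≤N) (⟦m!⟧≢𝟘 (ℕ.<⇒≤ m≤N)) ∘ ≡.trans (⟦⟧-* (suc m) (m !))

  ⟦pCk⟧≡𝟘 : ∀ {k} → 0 < k → k ≤ N → ⟦ suc N C k ⟧ ≡ 𝟘
  ⟦pCk⟧≡𝟘 {k} 0<k k≤N = Sum.[ id , (λ eq → contradiction eq factorials≢𝟘) ]′
    (⊗-integral ⟦ suc N C k ⟧ ⟦ k ! ℕ.* (suc N ∸ k) ! ⟧ product≡𝟘)
    where
    instance _ = k !* (suc N ∸ k) !≢0
    factorials≢𝟘 : ⟦ k ! ℕ.* (suc N ∸ k) ! ⟧ ≢ 𝟘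
    factorials≢𝟘 = ⊗-≢𝟘 (⟦m!⟧≢𝟘 k≤N) (⟦m!⟧≢𝟘 (ℕ.∸-monoʳ-≤ (suc N) 0<k)) ∘ ≡.trans (⟦⟧-* (k !) ((suc N ∸ k) !))
    product≡𝟘 : ⟦ suc N C k ⟧ ⊗ ⟦ k ! ℕ.* (suc N ∸ k) ! ⟧ ≡ 𝟘
    product≡𝟘 = begin
      ⟦ suc N C k ⟧ ⊗ ⟦ k ! ℕ.* (suc N ∸ k) ! ⟧                         ≡⟨ ⟦⟧-* (suc N C k) (k ! ℕ.* (suc N ∸ k) !) ⟩
      ⟦ (suc N C k) ℕ.* (k ! ℕ.* (suc N ∸ k) !) ⟧                       ≡⟨ cong (λ c → ⟦ c ℕ.* (k ! ℕ.* (suc N ∸ k) !) ⟧) (nCk≡n!/k![n-k]! k≤p) ⟩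
      ⟦ suc N ! / (k ! ℕ.* (suc N ∸ k) !) ℕ.* (k ! ℕ.* (suc N ∸ k) !) ⟧ ≡⟨ cong ⟦_⟧ (m/n*n≡m (k![n∸k]!∣n! k≤p)) ⟩
      ⟦ suc N ℕ.* N ! ⟧                                                 ≡⟨ ⟦⟧-* (suc N) (N !) ⟨
      ⟦ suc N ⟧ ⊗ ⟦ N ! ⟧                                               ≡⟨ cong (_⊗ ⟦ N ! ⟧) ⟦p⟧ ⟩
      𝟘 ⊗ ⟦ N ! ⟧                                                       ≡⟨ 𝔽.zeroˡ ⟦ N ! ⟧ ⟩
      𝟘                                                                 ∎
      where k≤p = ℕ.m≤n⇒m≤1+n k≤N

  frobenius-𝟙 : ∀ x → (x ⊕ 𝟙) ^ suc N ≡ x ^ suc N ⊕ 𝟙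
  frobenius-𝟙 x = begin
    (x ⊕ 𝟙) ^ suc N                                  ≡⟨ binomial-𝟙-init-last x N ⟩
    (term zero ⊕ ∑[ k < N ] term (suc k)) ⊕ x ^ suc N ≡⟨ cong (λ s → (term zero ⊕ s) ⊕ x ^ suc N) (∑-zero (term ∘ suc) inner-term≡𝟘) ⟩
    (𝟙 ⊗ 𝟙 ⊕ 𝟘) ⊕ x ^ suc N                          ≡⟨ cong (_⊕ x ^ suc N) (≡.trans (𝔽.+-identityʳ _) (𝔽.*-identityʳ 𝟙)) ⟩
    𝟙 ⊕ x ^ suc N                                    ≡⟨ 𝔽.+-comm 𝟙 (x ^ suc N) ⟩
    x ^ suc N ⊕ 𝟙                                    ∎
    where
    term : Fin (suc N) → Fin (suc N)
    term k = ⟦ suc N C toℕ k ⟧ ⊗ x ^ toℕ k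
    inner-term≡𝟘 : ∀ k → term (suc k) ≡ 𝟘
    inner-term≡𝟘 k = ≡.trans (cong (_⊗ x ^ suc (toℕ k)) (⟦pCk⟧≡𝟘 (s≤s z≤n) (Finₚ.toℕ<n k))) (𝔽.zeroˡ (x ^ suc (toℕ k)))

  fermat : ∀ x → x ^ suc N ≡ x
  fermat x = ≡.trans (cong (_^ suc N) (≡.sym (⟦toℕ⟧ x))) (≡.trans (⟦n⟧^p≡⟦n⟧ (toℕ x)) (⟦toℕ⟧ x))
    where
    ⟦n⟧^p≡⟦n⟧ : ∀ n → ⟦ n ⟧ ^ suc N ≡ ⟦ n ⟧
    ⟦n⟧^p≡⟦n⟧ zero    = 𝟘^n≡𝟘 {suc N} (s≤s z≤n)
    ⟦n⟧^p≡⟦n⟧ (suc n) = begin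
      ⟦ suc n ⟧ ^ suc N          ≡⟨ cong (_^ suc N) ⟦suc⟧ ⟩
      (⟦ n ⟧ ⊕ 𝟙) ^ suc N        ≡⟨ frobenius-𝟙 ⟦ n ⟧ ⟩
      ⟦ n ⟧ ^ suc N ⊕ 𝟙          ≡⟨ cong (_⊕ 𝟙) (⟦n⟧^p≡⟦n⟧ n) ⟩
      ⟦ n ⟧ ⊕ 𝟙                  ≡⟨ ⟦suc⟧ ⟨
      ⟦ suc n ⟧                  ∎
      where
      ⟦suc⟧ : ⟦ suc n ⟧ ≡ ⟦ n ⟧ ⊕ 𝟙
      ⟦suc⟧ = ≡.trans (cong ⟦_⟧ (ℕ.+-comm 1 n)) (≡.sym (⟦⟧-+ n 1))

  fermat-≢𝟘 : ∀ {x} → x ≢ 𝟘 → x ^ N ≡ 𝟙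
  fermat-≢𝟘 {x} x≢0 = ⊗-cancelˡ (x ^ N) 𝟙 x≢0 (≡.trans (fermat x) (≡.sym (𝔽.*-identityʳ x)))

  powerSum : ℕ → Fin (suc N)
  powerSum e = ∑[ c < suc N ] c ^ e

  powerSum-recurrence : ∀ k → ∑[ j ≤ k ] (⟦ suc k C toℕ j ⟧ ⊗ powerSum (toℕ j)) ≡ 𝟘
  powerSum-recurrence k = begin
    ∑[ j ≤ k ] (⟦ suc k C toℕ j ⟧ ⊗ powerSum (toℕ j))           ≡⟨ Sums.sum-cong-≗ {suc k} (λ j → Sums.*-distribˡ-sum ⟦ suc k C toℕ j ⟧ (_^ toℕ j)) ⟩
    ∑[ j ≤ k ] ∑[ c < suc N ] (⟦ suc k C toℕ j ⟧ ⊗ c ^ toℕ j)  ≡⟨ Sums.∑-comm {suc k} {suc N} (λ j c → ⟦ suc k C toℕ j ⟧ ⊗ c ^ toℕ j) ⟩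
    ∑[ c < suc N ] ∑[ j ≤ k ] (⟦ suc k C toℕ j ⟧ ⊗ c ^ toℕ j)  ≡⟨ Sums.sum-cong-≗ {suc N} difference ⟨
    ∑[ c < suc N ] (g (suc (toℕ c)) - g (toℕ c))               ≡⟨ ∑-telescope (suc N) g ⟩
    g (suc N) - g 0                                             ≡⟨ cong (λ x → x ^ suc k - g 0) ⟦p⟧ ⟩
    𝟘 ^ suc k - 𝟘 ^ suc k                                       ≡⟨ 𝔽.-‿inverseʳ (𝟘 ^ suc k) ⟩
    𝟘                                                           ∎
    where
    g : ℕ → Fin (suc N)
    g i = ⟦ i ⟧ ^ suc k
    difference : ∀ c → g (suc (toℕ c)) - g (toℕ c) ≡ ∑[ j ≤ k ] (⟦ suc k C toℕ j ⟧ ⊗ c ^ toℕ j)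
    difference c = begin
      g (suc (toℕ c)) - g (toℕ c)          ≡⟨ cong₂ (λ x y → x ^ suc k - y ^ suc k) ⟦toℕ⟧+𝟙 (⟦toℕ⟧ c) ⟩
      (c ⊕ 𝟙) ^ suc k - c ^ suc k          ≡⟨ cong (_- c ^ suc k) (binomial-𝟙-init-last c k) ⟩
      (S ⊕ c ^ suc k) - c ^ suc k          ≡⟨ solve 2 (λ s y → (s :+ y) :- y := s) ≡.refl S (c ^ suc k) ⟩
      S                                    ∎
      where
      S = ∑[ j ≤ k ] (⟦ suc k C toℕ j ⟧ ⊗ c ^ toℕ j)
      ⟦toℕ⟧+𝟙 : ⟦ suc (toℕ c) ⟧ ≡ c ⊕ 𝟙
      ⟦toℕ⟧+𝟙 = ≡.trans (cong ⟦_⟧ (ℕ.+-comm 1 (toℕ c))) (≡.trans (≡.sym (⟦⟧-+ (toℕ c) 1)) (cong (_⊕ 𝟙) (⟦toℕ⟧ c)))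

  powerSum-vanishes : ∀ k → k < N → powerSum k ≡ 𝟘
  powerSum-vanishes = <-rec (λ k → k < N → powerSum k ≡ 𝟘) vanishes
    where
    vanishes : ∀ k → (∀ {j} → j < k → j < N → powerSum j ≡ 𝟘) → k < N → powerSum k ≡ 𝟘
    vanishes k earlier k<N = ⊗-cancelˡ (powerSum k) 𝟘 (⟦⟧≢𝟘 (s≤s z≤n) k<N) (begin
      ⟦ suc k ⟧ ⊗ powerSum k                        ≡⟨ cong (λ c → ⟦ c ⟧ ⊗ powerSum k) [k+1]Ck≡k+1 ⟨
      ⟦ suc k C k ⟧ ⊗ powerSum k                    ≡⟨ cong (λ j → ⟦ suc k C j ⟧ ⊗ powerSum j) (Finₚ.toℕ-fromℕ k) ⟨
      term (Fin.fromℕ k)                            ≡⟨ ∑-single term (Fin.fromℕ k) earlier-term≡𝟘 ⟨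
      ∑[ j ≤ k ] term j                             ≡⟨ powerSum-recurrence k ⟩
      𝟘                                             ≡⟨ 𝔽.zeroʳ ⟦ suc k ⟧ ⟨
      ⟦ suc k ⟧ ⊗ 𝟘                                 ∎)
      where
      term : Fin (suc k) → Fin (suc N)
      term j = ⟦ suc k C toℕ j ⟧ ⊗ powerSum (toℕ j)
      earlier-term≡𝟘 : ∀ j → j ≢ Fin.fromℕ k → term j ≡ 𝟘
      earlier-term≡𝟘 j j≢k = ≡.trans (cong (⟦ suc k C toℕ j ⟧ ⊗_) (earlier j<k (ℕ.<-trans j<k k<N)))
                                     (𝔽.zeroʳ ⟦ suc k C toℕ j ⟧)
        where j<k = ≢fromℕ⇒toℕ< j j≢k
      [k+1]Ck≡k+1 : suc k C k ≡ suc k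
      [k+1]Ck≡k+1 = ≡.trans (nCk≡nC[n∸k] (ℕ.n≤1+n k)) (≡.trans (cong (suc k C_) (ℕ.m+n∸n≡m 1 k)) (nC1≡n (suc k)))

  powerSum-N : powerSum N ≡ - 𝟙
  powerSum-N = begin
    𝟘 ^ N ⊕ ∑[ c < N ] suc c ^ N        ≡⟨ cong₂ _⊕_ (𝟘^n≡𝟘 0<N) (Sums.sum-cong-≗ {N} (λ c → fermat-≢𝟘 λ ())) ⟩
    𝟘 ⊕ ∑[ c < N ] 𝟙                    ≡⟨ 𝔽.+-identityˡ _ ⟩
    ∑[ c < N ] 𝟙                        ≡⟨ Sums.sum-replicate N ⟩
    N Mult.× 𝟙                          ≡⟨ ×≡⟦⟧⊗ N 𝟙 ⟩
    ⟦ N ⟧ ⊗ 𝟙                           ≡⟨ 𝔽.*-identityʳ ⟦ N ⟧ ⟩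
    ⟦ N ⟧                               ≡⟨ G.inverseˡ-unique ⟦ N ⟧ 𝟙 (≡.trans (⟦⟧-+ N 1) (≡.trans (cong ⟦_⟧ (ℕ.+-comm N 1)) ⟦p⟧)) ⟩
    - 𝟙                                 ∎

  powerSum-periodic : ∀ {d} → 0 < d → powerSum (N ℕ.+ d) ≡ powerSum d
  powerSum-periodic {suc d} _ = Sums.sum-cong-≗ {suc N} λ c → begin
    c ^ (N ℕ.+ suc d)        ≡⟨ cong (c ^_) (ℕ.+-suc N d) ⟩
    c ^ (suc N ℕ.+ d)        ≡⟨ ^-homo-⊗ c (suc N) d ⟩
    c ^ suc N ⊗ c ^ d        ≡⟨ cong (_⊗ c ^ d) (fermat c) ⟩
    c ^ suc d                ∎

  powerSum-offDiagonal : ∀ {n m} → n < N → m < N → n ≢ m → powerSum (n ℕ.+ (N ∸ m)) ≡ 𝟘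
  powerSum-offDiagonal {n} {m} n<N m<N n≢m with ℕ.<-cmp n m
  ... | tri≈ _ n≡m _ = contradiction n≡m n≢m
  ... | tri< n<m _ _ = powerSum-vanishes (n ℕ.+ (N ∸ m))
    (ℕ.<-≤-trans (ℕ.+-monoˡ-< (N ∸ m) n<m) (ℕ.≤-reflexive (ℕ.m+[n∸m]≡n (ℕ.<⇒≤ m<N))))
  ... | tri> _ _ m<n = begin
    powerSum (n ℕ.+ (N ∸ m))           ≡⟨ cong powerSum exponent ⟩
    powerSum (N ℕ.+ (n ∸ m))           ≡⟨ powerSum-periodic (ℕ.m<n⇒0<n∸m m<n) ⟩
    powerSum (n ∸ m)                   ≡⟨ powerSum-vanishes (n ∸ m) (ℕ.≤-<-trans (ℕ.m∸n≤m n m) n<N) ⟩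
    𝟘                                  ∎
    where
    exponent : n ℕ.+ (N ∸ m) ≡ N ℕ.+ (n ∸ m)
    exponent = begin
      n ℕ.+ (N ∸ m)                 ≡⟨ ℕ.+-∸-assoc n (ℕ.<⇒≤ m<N) ⟨
      n ℕ.+ N ∸ m                   ≡⟨ cong (_∸ m) (ℕ.+-comm n N) ⟩
      N ℕ.+ n ∸ m                   ≡⟨ ℕ.+-∸-assoc N (ℕ.<⇒≤ m<n) ⟩
      N ℕ.+ (n ∸ m)                 ∎

  transform : (ℕ → Fin (suc N)) → Fin (suc N) → Fin (suc N)
  transform α c = ∑[ n < N ] (α (toℕ n) ⊗ c ^ toℕ n)

  transform-inversion : ∀ α (m : Fin N) → ∑[ c < suc N ] (transform α c ⊗ c ^ (N ∸ toℕ m)) ≡ - α (toℕ m)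
  transform-inversion α m = begin
    ∑[ c < suc N ] (transform α c ⊗ c ^ (N ∸ toℕ m))              ≡⟨ Sums.sum-cong-≗ {suc N} expand ⟩
    ∑[ c < suc N ] ∑[ n < N ] (α (toℕ n) ⊗ c ^ e n)               ≡⟨ Sums.∑-comm {suc N} {N} (λ c n → α (toℕ n) ⊗ c ^ e n) ⟩
    ∑[ n < N ] ∑[ c < suc N ] (α (toℕ n) ⊗ c ^ e n)               ≡⟨ Sums.sum-cong-≗ {N} (λ n → Sums.*-distribˡ-sum (α (toℕ n)) (_^ e n)) ⟨
    ∑[ n < N ] (α (toℕ n) ⊗ powerSum (e n))                       ≡⟨ ∑-single (λ n → α (toℕ n) ⊗ powerSum (e n)) m off-diagonal ⟩
    α (toℕ m) ⊗ powerSum (e m)                                     ≡⟨ cong (λ k → α (toℕ m) ⊗ powerSum k) (ℕ.m+[n∸m]≡n (ℕ.<⇒≤ (Finₚ.toℕ<n m))) ⟩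
    α (toℕ m) ⊗ powerSum N                                         ≡⟨ cong (α (toℕ m) ⊗_) powerSum-N ⟩
    α (toℕ m) ⊗ - 𝟙                                                ≡⟨ solve 1 (λ a → a :* :- con (+ 1) := :- a) ≡.refl (α (toℕ m)) ⟩
    - α (toℕ m)                                                    ∎
    where
    e : Fin N → ℕ
    e n = toℕ n ℕ.+ (N ∸ toℕ m)
    expand : ∀ c → transform α c ⊗ c ^ (N ∸ toℕ m) ≡ ∑[ n < N ] (α (toℕ n) ⊗ c ^ e n)
    expand c = ≡.trans (Sums.*-distribʳ-sum {N} (c ^ (N ∸ toℕ m)) (λ n → α (toℕ n) ⊗ c ^ toℕ n)) (Sums.sum-cong-≗ {N} λ n → begin
      α (toℕ n) ⊗ c ^ toℕ n ⊗ c ^ (N ∸ toℕ m)      ≡⟨ 𝔽.*-assoc (α (toℕ n)) (c ^ toℕ n) (c ^ (N ∸ toℕ m)) ⟩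
      α (toℕ n) ⊗ (c ^ toℕ n ⊗ c ^ (N ∸ toℕ m))    ≡⟨ cong (α (toℕ n) ⊗_) (^-homo-⊗ c (toℕ n) (N ∸ toℕ m)) ⟨
      α (toℕ n) ⊗ c ^ e n                          ∎)
    off-diagonal : ∀ n → n ≢ m → α (toℕ n) ⊗ powerSum (e n) ≡ 𝟘
    off-diagonal n n≢m = ≡.trans (cong (α (toℕ n) ⊗_)
      (powerSum-offDiagonal (Finₚ.toℕ<n n) (Finₚ.toℕ<n m) (n≢m ∘ Finₚ.toℕ-injective))) (𝔽.zeroʳ (α (toℕ n)))

  cubicRoot≢𝟘 : ∀ {x} → cubic x ≡ 𝟘 → x ≢ 𝟘
  cubicRoot≢𝟘 root ≡.refl = 𝟙≢𝟘 (G.⁻¹-injective (≡.trans cubic𝟘 (≡.trans root (≡.sym G.ε⁻¹≈ε))))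
    where
    cubic𝟘 : - 𝟙 ≡ cubic 𝟘
    cubic𝟘 = solve 0 (:- con (+ 1) := con (+ 0) :^ 3 :- con (+ 0) :- con (+ 1)) ≡.refl

  dividedDifference : Fin (suc N) → Fin (suc N) → Fin (suc N)
  dividedDifference r s = r ⊗ r ⊕ r ⊗ s ⊕ s ⊗ s - 𝟙

  cubic-difference : ∀ r s → cubic r - cubic s ≡ (r - s) ⊗ dividedDifference r s
  cubic-difference = solve 2 (λ r s → (r :^ 3 :- r :- con (+ 1)) :- (s :^ 3 :- s :- con (+ 1))
                                    := (r :- s) :* (r :* r :+ r :* s :+ s :* s :- con (+ 1))) ≡.refl

  cubic-negatedSum : ∀ r s → ⟦ 2 ⟧ ⊗ cubic (- (r ⊕ s)) ≡ cubic r ⊕ cubic s - ⟦ 3 ⟧ ⊗ (r ⊕ s) ⊗ dividedDifference r s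
  cubic-negatedSum = solve 2 (λ r s → con (+ 2) :* ((:- (r :+ s)) :^ 3 :- (:- (r :+ s)) :- con (+ 1))
                               := (r :^ 3 :- r :- con (+ 1)) :+ (s :^ 3 :- s :- con (+ 1))
                                  :- con (+ 3) :* (r :+ s) :* (r :* r :+ r :* s :+ s :* s :- con (+ 1))) ≡.refl

  dividedDifference≡𝟘 : ∀ {r s} → r ≢ s → cubic r ≡ 𝟘 → cubic s ≡ 𝟘 → dividedDifference r s ≡ 𝟘
  dividedDifference≡𝟘 {r} {s} r≢s fr≡0 fs≡0 =
    Sum.[ (λ r-s≡0 → contradiction (G.x∙y⁻¹≈ε⇒x≈y r s r-s≡0) r≢s) , id ]′ (⊗-integral (r - s) (dividedDifference r s) (begin
      (r - s) ⊗ dividedDifference r s    ≡⟨ cubic-difference r s ⟨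
      cubic r - cubic s                  ≡⟨ cong₂ _-_ fr≡0 fs≡0 ⟩
      𝟘 - 𝟘                              ≡⟨ 𝔽.-‿inverseʳ 𝟘 ⟩
      𝟘                                  ∎))

  thirdRoot : 2 ≤ N → ∀ {r s} → r ≢ s → cubic r ≡ 𝟘 → cubic s ≡ 𝟘 → cubic (- (r ⊕ s)) ≡ 𝟘
  thirdRoot 2≤N {r} {s} r≢s fr≡0 fs≡0 = ⊗-cancelˡ (cubic (- (r ⊕ s))) 𝟘 2≢𝟘 (begin
    ⟦ 2 ⟧ ⊗ cubic (- (r ⊕ s))                      ≡⟨ cubic-negatedSum r s ⟩
    cubic r ⊕ cubic s - ⟦ 3 ⟧ ⊗ (r ⊕ s) ⊗ dividedDifference r s    ≡⟨ cong₂ (λ x y → x - ⟦ 3 ⟧ ⊗ (r ⊕ s) ⊗ y) (cong₂ _⊕_ fr≡0 fs≡0) (dividedDifference≡𝟘 r≢s fr≡0 fs≡0) ⟩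
    𝟘 ⊕ 𝟘 - ⟦ 3 ⟧ ⊗ (r ⊕ s) ⊗ 𝟘                    ≡⟨ solve 1 (λ x → con (+ 0) :+ con (+ 0) :- con (+ 3) :* x :* con (+ 0) := con (+ 0) :* con (+ 2)) ≡.refl (r ⊕ s) ⟩
    𝟘 ⊗ ⟦ 2 ⟧                                       ≡⟨ 𝔽.*-comm 𝟘 (⟦ 2 ⟧) ⟩
    ⟦ 2 ⟧ ⊗ 𝟘                                       ∎)
    where
    2≢𝟘 : ⟦ 2 ⟧ ≢ 𝟘
    2≢𝟘 = ⟦⟧≢𝟘 (s≤s z≤n) 2≤N

  repeatedRoot⇒p≡23 : ∀ r s → cubic r ≡ 𝟘 → dividedDifference r s ≡ 𝟘 → r ⊕ r ⊕ s ≡ 𝟘 → suc N ≡ 23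
  repeatedRoot⇒p≡23 r s f≡0 q≡0 e≡0 = Sum.[ p≢1 , id ]′ (prime⇒irreducible 23-prime (⟦⟧≡𝟘⇒∣ 23 ⟦23⟧≡𝟘))
    where
    -- if s = -2r then w = 3r² - 1, and 23 = 4w - 3(2r - 3)(rw - 3(r³ - r - 1))
    combination : Fin (suc N) → Fin (suc N) → Fin (suc N) → Fin (suc N) → Fin (suc N)
    combination q e f r = ⟦ 4 ⟧ ⊗ w - ⟦ 3 ⟧ ⊗ (⟦ 2 ⟧ ⊗ r - ⟦ 3 ⟧) ⊗ (r ⊗ w - ⟦ 3 ⟧ ⊗ f)
      where w = q ⊕ e ⊗ (⟦ 3 ⟧ ⊗ r - e)
    23≡combination : ∀ r s → ⟦ 23 ⟧ ≡ combination (dividedDifference r s) (r ⊕ r ⊕ s) (cubic r) r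
    23≡combination = solve 2 (λ r s →
      let q = r :* r :+ r :* s :+ s :* s :- con (+ 1)
          e = r :+ r :+ s
          f = r :^ 3 :- r :- con (+ 1)
          w = q :+ e :* (con (+ 3) :* r :- e)
      in con (+ 23) := con (+ 4) :* w :- con (+ 3) :* (con (+ 2) :* r :- con (+ 3)) :* (r :* w :- con (+ 3) :* f)) ≡.refl
    combination-𝟘 : ∀ r → combination 𝟘 𝟘 𝟘 r ≡ 𝟘
    combination-𝟘 = solve 1 (λ r →
      let w = con (+ 0) :+ con (+ 0) :* (con (+ 3) :* r :- con (+ 0))
      in con (+ 4) :* w :- con (+ 3) :* (con (+ 2) :* r :- con (+ 3)) :* (r :* w :- con (+ 3) :* con (+ 0)) := con (+ 0)) ≡.refl
    ⟦23⟧≡𝟘 : ⟦ 23 ⟧ ≡ 𝟘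
    ⟦23⟧≡𝟘 = begin
      ⟦ 23 ⟧                                           ≡⟨ 23≡combination r s ⟩
      combination (dividedDifference r s) (r ⊕ r ⊕ s) (cubic r) r      ≡⟨ cong₂ (λ q e → combination q e (cubic r) r) q≡0 e≡0 ⟩
      combination 𝟘 𝟘 (cubic r) r                      ≡⟨ cong (λ f → combination 𝟘 𝟘 f r) f≡0 ⟩
      combination 𝟘 𝟘 𝟘 r                              ≡⟨ combination-𝟘 r ⟩
      𝟘                                                ∎
    23-prime : Prime 23
    23-prime = from-yes (prime? 23)
    p≢1 : suc N ≡ 1 → suc N ≡ 23
    p≢1 p≡1 = contradiction (≡.sym (ℕ.suc-injective p≡1)) (ℕ.<⇒≢ 0<N)

  twoRoots⇒p≡23 : 2 ≤ N → FewerThan3Roots {suc N} → ∀ {r s : Fin (suc N)} → IsCubicRoot r → IsCubicRoot s → r ≢ s → suc N ≡ 23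
  twoRoots⇒p≡23 2≤N fewerThan3 {r} {s} r-root s-root r≢s = byCases (t ≟ r) (t ≟ s)
    where
    t : Fin (suc N)
    t = - (r ⊕ s)
    fr≡0 : cubic r ≡ 𝟘
    fr≡0 = IsCubicRoot⇒cubic≡𝟘 r r-root
    fs≡0 : cubic s ≡ 𝟘
    fs≡0 = IsCubicRoot⇒cubic≡𝟘 s s-root
    double : ∀ {x y : Fin (suc N)} → - (x ⊕ y) ≡ x → x ⊕ x ⊕ y ≡ 𝟘
    double {x} {y} -[x+y]≡x = ≡.trans (𝔽.+-assoc x x y) (≡.trans (cong (_⊕ (x ⊕ y)) (≡.sym -[x+y]≡x)) (𝔽.-‿inverseˡ (x ⊕ y)))
    byCases : Dec (t ≡ r) → Dec (t ≡ s) → suc N ≡ 23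
    byCases (yes t≡r) _         = repeatedRoot⇒p≡23 r s fr≡0 (dividedDifference≡𝟘 r≢s fr≡0 fs≡0) (double t≡r)
    byCases (no _)    (yes t≡s) = repeatedRoot⇒p≡23 s r fs≡0 (dividedDifference≡𝟘 (r≢s ∘ ≡.sym) fs≡0 fr≡0)
                                    (double (≡.trans (cong (-_) (𝔽.+-comm s r)) t≡s))
    byCases (no t≢r)  (no t≢s)  = ⊥-elim (fewerThan3
      (r , s , t , r-root , s-root , cubic≡𝟘⇒IsCubicRoot t (thirdRoot 2≤N r≢s fr≡0 fs≡0) , r≢s , t≢s ∘ ≡.sym , t≢r ∘ ≡.sym))

  module _ (α : ℕ → Fin (suc N)) (periodic : ∀ n → α (n ℕ.+ N) ≡ α n)
           (recurrence : ∀ n → α n ≡ α (n ℕ.+ 2) ⊕ α (n ℕ.+ 3)) (c : Fin (suc N)) (cᴺ≡𝟙 : c ^ N ≡ 𝟙) where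

    private
      T = transform α c

      shifted : ℕ → Fin (suc N)
      shifted k = ∑[ n < N ] (α (toℕ n ℕ.+ k) ⊗ c ^ toℕ n)

      term : ℕ → Fin (suc N)
      term n = α n ⊗ c ^ n

      term-periodic : ∀ n → term (n ℕ.+ N) ≡ term n
      term-periodic n = cong₂ _⊗_ (periodic n) (begin
        c ^ (n ℕ.+ N)     ≡⟨ ^-homo-⊗ c n N ⟩
        c ^ n ⊗ c ^ N     ≡⟨ cong (c ^ n ⊗_) cᴺ≡𝟙 ⟩
        c ^ n ⊗ 𝟙         ≡⟨ 𝔽.*-identityʳ (c ^ n) ⟩
        c ^ n             ∎)

      shifted⊗cᵏ≡T : ∀ k → shifted k ⊗ c ^ k ≡ T
      shifted⊗cᵏ≡T k = begin
        shifted k ⊗ c ^ k                                ≡⟨ Sums.*-distribʳ-sum {N} (c ^ k) (λ n → α (toℕ n ℕ.+ k) ⊗ c ^ toℕ n) ⟩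
        ∑[ n < N ] (α (toℕ n ℕ.+ k) ⊗ c ^ toℕ n ⊗ c ^ k) ≡⟨ Sums.sum-cong-≗ {N} (λ n → cong-term (toℕ n)) ⟩
        ∑[ n < N ] term (toℕ n ℕ.+ k)                    ≡⟨ ∑-shift-periodic N term term-periodic k ⟩
        T                                                ∎
        where
        cong-term : ∀ n → α (n ℕ.+ k) ⊗ c ^ n ⊗ c ^ k ≡ term (n ℕ.+ k)
        cong-term n = ≡.trans (𝔽.*-assoc (α (n ℕ.+ k)) (c ^ n) (c ^ k)) (cong (α (n ℕ.+ k) ⊗_) (≡.sym (^-homo-⊗ c n k)))

      T≡shifted₂+shifted₃ : T ≡ shifted 2 ⊕ shifted 3
      T≡shifted₂+shifted₃ = ≡.trans
        (Sums.sum-cong-≗ {N} (λ n → split (toℕ n)))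
        (Sums.∑-distrib-+ {N} (λ n → α (toℕ n ℕ.+ 2) ⊗ c ^ toℕ n) (λ n → α (toℕ n ℕ.+ 3) ⊗ c ^ toℕ n))
        where
        split : ∀ n → term n ≡ α (n ℕ.+ 2) ⊗ c ^ n ⊕ α (n ℕ.+ 3) ⊗ c ^ n
        split n = ≡.trans (cong (_⊗ c ^ n) (recurrence n)) (𝔽.distribʳ (c ^ n) (α (n ℕ.+ 2)) (α (n ℕ.+ 3)))

      T⊗c³ : T ⊗ c ^ 3 ≡ c ⊗ T ⊕ T
      T⊗c³ = begin
        T ⊗ c ^ 3                                   ≡⟨ cong (_⊗ c ^ 3) T≡shifted₂+shifted₃ ⟩
        (shifted 2 ⊕ shifted 3) ⊗ c ^ 3             ≡⟨ 𝔽.distribʳ (c ^ 3) (shifted 2) (shifted 3) ⟩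
        shifted 2 ⊗ c ^ 3 ⊕ shifted 3 ⊗ c ^ 3       ≡⟨ cong (_⊕ shifted 3 ⊗ c ^ 3) (CS.x∙yz≈y∙xz (shifted 2) c (c ^ 2)) ⟩
        c ⊗ (shifted 2 ⊗ c ^ 2) ⊕ shifted 3 ⊗ c ^ 3 ≡⟨ cong₂ _⊕_ (cong (c ⊗_) (shifted⊗cᵏ≡T 2)) (shifted⊗cᵏ≡T 3) ⟩
        c ⊗ T ⊕ T                                   ∎

    transform-annihilated : transform α c ⊗ cubic c ≡ 𝟘
    transform-annihilated = begin
      T ⊗ cubic c                         ≡⟨ solve 2 (λ t c → t :* (c :^ 3 :- c :- con (+ 1)) := t :* c :^ 3 :- t :* c :- t) ≡.refl T c ⟩
      T ⊗ c ^ 3 - T ⊗ c - T               ≡⟨ cong (λ x → x - T ⊗ c - T) T⊗c³ ⟩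
      (c ⊗ T ⊕ T) - T ⊗ c - T             ≡⟨ solve 2 (λ t c → (c :* t :+ t) :- t :* c :- t := con (+ 0)) ≡.refl T c ⟩
      𝟘                                   ∎

-- Over 𝔽₂₃ the cubic factors as (X - 3)(X - 10)², and everything here is decided by evaluation.
module TwoRootsModulo23 where

  open Residues 23

  private
    infix 4 _≟_
    _≟_ : DecidableEquality (Fin 23)
    _≟_ = Finₚ._≟_

  cubicRoots : ∀ x → cubic x ≡ 𝟘 → x ≡ ⟦ 3 ⟧ ⊎ x ≡ ⟦ 10 ⟧
  cubicRoots = toWitness {a? = Finₚ.all? λ x → (cubic x ≟ 𝟘) →-dec ((x ≟ ⟦ 3 ⟧) ⊎-dec (x ≟ ⟦ 10 ⟧))} _

  sequence : (r s u : Fin 23) → ℕ → Fin 23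
  sequence r s u m = - (u ⊗ r ^ (22 ∸ m) ⊕ (- 𝟙 - u) ⊗ s ^ (22 ∸ m))

  OneCoefficientVanishes : Fin 23 → Set
  OneCoefficientVanishes u = u ≡ 𝟘 ⊎ - 𝟙 - u ≡ 𝟘

  OrHitsBelow2 : (r s u : Fin 23) → Set
  OrHitsBelow2 r s u = OneCoefficientVanishes u ⊎ ∃ λ (m : Fin 21) → toℕ (sequence r s u (suc (toℕ m))) < 2

  orHitsBelow2? : ∀ r s u → Dec (OrHitsBelow2 r s u)
  orHitsBelow2? r s u = ((u ≟ 𝟘) ⊎-dec (- 𝟙 - u ≟ 𝟘)) ⊎-dec Finₚ.any? (λ m → toℕ (sequence r s u (suc (toℕ m))) ℕ.<? 2)

  oneCoefficientVanishes : ∀ r s u → cubic r ≡ 𝟘 → cubic s ≡ 𝟘 → r ≢ s →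
                           (∀ m → 1 ≤ m → m < 22 → 2 ≤ toℕ (sequence r s u m)) → OneCoefficientVanishes u
  oneCoefficientVanishes r s u r-root s-root r≢s ≥2 = byRoots (cubicRoots r r-root) (cubicRoots s s-root)
    where
    noHit : OrHitsBelow2 r s u → OneCoefficientVanishes u
    noHit (inj₁ vanishes)       = vanishes
    noHit (inj₂ (m , seq<2))    = contradiction (≥2 (suc (toℕ m)) (s≤s z≤n) (s≤s (Finₚ.toℕ<n m))) (ℕ.<⇒≱ seq<2)
    byRoots : r ≡ ⟦ 3 ⟧ ⊎ r ≡ ⟦ 10 ⟧ → s ≡ ⟦ 3 ⟧ ⊎ s ≡ ⟦ 10 ⟧ → OneCoefficientVanishes u
    byRoots (inj₁ ≡.refl) (inj₁ ≡.refl) = contradiction ≡.refl r≢s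
    byRoots (inj₂ ≡.refl) (inj₂ ≡.refl) = contradiction ≡.refl r≢s
    byRoots (inj₁ ≡.refl) (inj₂ ≡.refl) = noHit (toWitness {a? = Finₚ.all? (orHitsBelow2? ⟦ 3 ⟧ ⟦ 10 ⟧)} _ u)
    byRoots (inj₂ ≡.refl) (inj₁ ≡.refl) = noHit (toWitness {a? = Finₚ.all? (orHitsBelow2? ⟦ 10 ⟧ ⟦ 3 ⟧)} _ u)

twoRootCoefficients : ∀ {N} → N ≡ 22 → let open Residues (suc N) in
  ∀ r s u → cubic r ≡ 𝟘 → cubic s ≡ 𝟘 → r ≢ s →
  (∀ m → 1 ≤ m → m < N → 2 ≤ toℕ (- (u ⊗ r ^ (N ∸ m) ⊕ (- 𝟙 - u) ⊗ s ^ (N ∸ m)))) →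
  u ≡ 𝟘 ⊎ - 𝟙 - u ≡ 𝟘
twoRootCoefficients ≡.refl = TwoRootsModulo23.oneCoefficientVanishes

module Forward
  (N : ℕ) (p-prime : Prime (suc N)) (2≤N : 2 ≤ N) (fewerThan3 : FewerThan3Roots {suc N})
  (α : ℕ → Fin (suc N)) (α₀≡𝟙 : α 0 ≡ 𝟙)
  (periodic : ∀ n → α (n ℕ.+ N) ≡ α n)
  (recurrence : ∀ n → α n ≡ α (n ℕ.+ 2) ⊕ α (n ℕ.+ 3))
  (avoids𝟘𝟙 : ∀ m → 1 ≤ m → m < N → 2 ≤ toℕ (α m))
  where

  open PrimeField N p-prime
  open CommutativeMonoidSums 𝔽.+-commutativeMonoid using (∑-zero; ∑-single; ∑-pair)
  open ≡-Reasoning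
  private
    module G = GroupProperties 𝔽.+-group
    module R = RingProperties 𝔽.ring

  m₀ : Fin N
  m₀ = Fin.fromℕ< 0<N

  term : Fin N → Fin (suc N) → Fin (suc N)
  term m c = transform α c ⊗ c ^ (N ∸ toℕ m)

  nonRoot-term≡𝟘 : ∀ m c → cubic c ≢ 𝟘 → term m c ≡ 𝟘
  nonRoot-term≡𝟘 m c fc≢0 with c ≟ 𝟘
  ... | yes ≡.refl = ≡.trans (cong (transform α 𝟘 ⊗_) (𝟘^n≡𝟘 (ℕ.m<n⇒0<n∸m (Finₚ.toℕ<n m)))) (𝔽.zeroʳ (transform α 𝟘))
  ... | no c≢0     = ≡.trans (cong (_⊗ c ^ (N ∸ toℕ m)) T≡𝟘) (𝔽.zeroˡ (c ^ (N ∸ toℕ m)))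
    where
    T≡𝟘 : transform α c ≡ 𝟘
    T≡𝟘 = Sum.[ id , (λ fc≡0 → contradiction fc≡0 fc≢0) ]′
            (⊗-integral (transform α c) (cubic c) (transform-annihilated α periodic recurrence c (fermat-≢𝟘 c≢0)))

  geometric : ∀ {r u : Fin (suc N)} → r ≢ 𝟘 → (∀ (m : Fin N) → - α (toℕ m) ≡ u ⊗ r ^ (N ∸ toℕ m)) →
              ∃ λ b → ∀ n → α n ≡ b ^ n
  geometric {r} {u} r≢0 -α≡ = b , periodic-agree 0<N α (b ^_) periodic b^-periodic α≡bᵐ
    where
    rᴺ≡𝟙 : r ^ N ≡ 𝟙
    rᴺ≡𝟙 = fermat-≢𝟘 r≢0
    b : Fin (suc N)
    b = r ^ (N ∸ 1)
    b⊗r≡𝟙 : b ⊗ r ≡ 𝟙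
    b⊗r≡𝟙 = ≡.trans (𝔽.*-comm b r) (≡.trans (cong (r ^_) (ℕ.suc-pred N {{ℕ.>-nonZero 0<N}})) rᴺ≡𝟙)
    b≢𝟘 : b ≢ 𝟘
    b≢𝟘 b≡0 = 𝟙≢𝟘 (≡.trans (≡.sym b⊗r≡𝟙) (≡.trans (cong (_⊗ r) b≡0) (𝔽.zeroˡ r)))
    b^-periodic : ∀ n → b ^ (n ℕ.+ N) ≡ b ^ n
    b^-periodic n = ≡.trans (^-homo-⊗ b n N) (≡.trans (cong (b ^ n ⊗_) (fermat-≢𝟘 b≢𝟘)) (𝔽.*-identityʳ (b ^ n)))
    u≡-𝟙 : u ≡ - 𝟙
    u≡-𝟙 = begin
      u                               ≡⟨ 𝔽.*-identityʳ u ⟨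
      u ⊗ 𝟙                           ≡⟨ cong (u ⊗_) rᴺ≡𝟙 ⟨
      u ⊗ r ^ N                       ≡⟨ cong (λ k → u ⊗ r ^ (N ∸ k)) (Finₚ.toℕ-fromℕ< 0<N) ⟨
      u ⊗ r ^ (N ∸ toℕ m₀)            ≡⟨ -α≡ m₀ ⟨
      - α (toℕ m₀)                    ≡⟨ cong (λ k → - α k) (Finₚ.toℕ-fromℕ< 0<N) ⟩
      - α 0                           ≡⟨ cong (-_) α₀≡𝟙 ⟩
      - 𝟙                             ∎
    α≡bᵐ : ∀ (m : Fin N) → α (toℕ m) ≡ b ^ toℕ m
    α≡bᵐ m = ⊗-cancelʳ (α (toℕ m)) (b ^ toℕ m) (^-≢𝟘 (toℕ m) r≢0) (begin
      α (toℕ m) ⊗ r ^ toℕ m            ≡⟨ cong (_⊗ r ^ toℕ m) α≡r^ ⟩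
      r ^ (N ∸ toℕ m) ⊗ r ^ toℕ m      ≡⟨ ^-homo-⊗ r (N ∸ toℕ m) (toℕ m) ⟨
      r ^ (N ∸ toℕ m ℕ.+ toℕ m)        ≡⟨ cong (r ^_) (ℕ.m∸n+n≡m (ℕ.<⇒≤ (Finₚ.toℕ<n m))) ⟩
      r ^ N                            ≡⟨ rᴺ≡𝟙 ⟩
      𝟙                                ≡⟨ 𝟙^n≡𝟙 (toℕ m) ⟨
      𝟙 ^ toℕ m                        ≡⟨ cong (_^ toℕ m) b⊗r≡𝟙 ⟨
      (b ⊗ r) ^ toℕ m                  ≡⟨ ^-distrib-⊗ b r (toℕ m) ⟩
      b ^ toℕ m ⊗ r ^ toℕ m            ∎)
      where
      α≡r^ : α (toℕ m) ≡ r ^ (N ∸ toℕ m)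
      α≡r^ = G.⁻¹-injective (≡.trans (-α≡ m) (≡.trans (cong (_⊗ r ^ (N ∸ toℕ m)) u≡-𝟙) (R.-1*x≈-x (r ^ (N ∸ toℕ m)))))

  root : ∃ λ x → cubic x ≡ 𝟘
  root = decidable-stable (Finₚ.any? λ x → cubic x ≟ 𝟘) λ none → 𝟙≢𝟘 (G.⁻¹-injective (begin
    - 𝟙                                ≡⟨ cong (-_) α₀≡𝟙 ⟨
    - α 0                              ≡⟨ cong (λ k → - α k) (Finₚ.toℕ-fromℕ< 0<N) ⟨
    - α (toℕ m₀)                       ≡⟨ transform-inversion α m₀ ⟨
    ∑[ c < suc N ] term m₀ c           ≡⟨ ∑-zero (term m₀) (λ c → nonRoot-term≡𝟘 m₀ c (λ fc≡0 → none (c , fc≡0))) ⟩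
    𝟘                                  ≡⟨ G.ε⁻¹≈ε ⟨
    - 𝟘                                ∎))

  oneRoot : ∀ {r} → cubic r ≡ 𝟘 → (∀ c → c ≢ r → cubic c ≢ 𝟘) → ∃ λ b → ∀ n → α n ≡ b ^ n
  oneRoot {r} fr≡0 unique = geometric {u = transform α r} (cubicRoot≢𝟘 fr≡0) λ m →
    ≡.trans (≡.sym (transform-inversion α m)) (∑-single (term m) r (λ c c≢r → nonRoot-term≡𝟘 m c (unique c c≢r)))

  term-m₀ : ∀ {x} → x ≢ 𝟘 → term m₀ x ≡ transform α x
  term-m₀ {x} x≢0 = begin
    transform α x ⊗ x ^ (N ∸ toℕ m₀)   ≡⟨ cong (λ k → transform α x ⊗ x ^ (N ∸ k)) (Finₚ.toℕ-fromℕ< 0<N) ⟩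
    transform α x ⊗ x ^ N              ≡⟨ cong (transform α x ⊗_) (fermat-≢𝟘 x≢0) ⟩
    transform α x ⊗ 𝟙                  ≡⟨ 𝔽.*-identityʳ (transform α x) ⟩
    transform α x                      ∎

  module TwoRoots {r s : Fin (suc N)} (fr≡0 : cubic r ≡ 𝟘) (fs≡0 : cubic s ≡ 𝟘) (r≢s : r ≢ s) where

    u v : Fin (suc N)
    u = transform α r
    v = transform α s

    -α≡ : ∀ m → - α (toℕ m) ≡ term m r ⊕ term m s
    -α≡ m = ≡.trans (≡.sym (transform-inversion α m)) (∑-pair (term m) r s r≢s λ c c≢r c≢s →
      nonRoot-term≡𝟘 m c (λ fc≡0 → fewerThan3 (r , s , c , cubic≡𝟘⇒IsCubicRoot r fr≡0 , cubic≡𝟘⇒IsCubicRoot s fs≡0 ,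
                                                  cubic≡𝟘⇒IsCubicRoot c fc≡0 , r≢s , c≢s ∘ ≡.sym , c≢r ∘ ≡.sym)))

    v≡-𝟙-u : v ≡ - 𝟙 - u
    v≡-𝟙-u = begin
      v                                  ≡⟨ solve 2 (λ u v → v := (u :+ v) :- u) ≡.refl u v ⟩
      (u ⊕ v) - u                        ≡⟨ cong (_- u) u⊕v≡-𝟙 ⟩
      - 𝟙 - u                            ∎
      where
      u⊕v≡-𝟙 : u ⊕ v ≡ - 𝟙
      u⊕v≡-𝟙 = begin
        u ⊕ v                            ≡⟨ cong₂ _⊕_ (term-m₀ (cubicRoot≢𝟘 fr≡0)) (term-m₀ (cubicRoot≢𝟘 fs≡0)) ⟨
        term m₀ r ⊕ term m₀ s            ≡⟨ -α≡ m₀ ⟨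
        - α (toℕ m₀)                     ≡⟨ cong (λ k → - α k) (Finₚ.toℕ-fromℕ< 0<N) ⟩
        - α 0                            ≡⟨ cong (-_) α₀≡𝟙 ⟩
        - 𝟙                              ∎

    sequence : ℕ → Fin (suc N)
    sequence k = - (u ⊗ r ^ (N ∸ k) ⊕ (- 𝟙 - u) ⊗ s ^ (N ∸ k))

    α≡sequence : ∀ m → m < N → α m ≡ sequence m
    α≡sequence m m<N = begin
      α m                                   ≡⟨ G.⁻¹-involutive (α m) ⟨
      - - α m                               ≡⟨ cong (λ k → - - α k) (Finₚ.toℕ-fromℕ< m<N) ⟨
      - - α (toℕ m′)                        ≡⟨ cong (-_) (-α≡ m′) ⟩
      - (term m′ r ⊕ term m′ s)             ≡⟨ cong (λ k → - (u ⊗ r ^ (N ∸ k) ⊕ v ⊗ s ^ (N ∸ k))) (Finₚ.toℕ-fromℕ< m<N) ⟩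
      - (u ⊗ r ^ (N ∸ m) ⊕ v ⊗ s ^ (N ∸ m)) ≡⟨ cong (λ w → - (u ⊗ r ^ (N ∸ m) ⊕ w ⊗ s ^ (N ∸ m))) v≡-𝟙-u ⟩
      sequence m                            ∎
      where m′ = Fin.fromℕ< m<N

    oneCoefficientVanishes : u ≡ 𝟘 ⊎ - 𝟙 - u ≡ 𝟘
    oneCoefficientVanishes = twoRootCoefficients N≡22 r s u fr≡0 fs≡0 r≢s λ m 1≤m m<N →
      ≡.subst (λ x → 2 ≤ toℕ x) (α≡sequence m m<N) (avoids𝟘𝟙 m 1≤m m<N)
      where
      N≡22 : N ≡ 22
      N≡22 = ℕ.suc-injective (twoRoots⇒p≡23 2≤N fewerThan3 (cubic≡𝟘⇒IsCubicRoot r fr≡0) (cubic≡𝟘⇒IsCubicRoot s fs≡0) r≢s)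

    powers : ∃ λ b → ∀ n → α n ≡ b ^ n
    powers = Sum.[ u≡𝟘⇒powers , v≡𝟘⇒powers ]′ oneCoefficientVanishes
      where
      u≡𝟘⇒powers : u ≡ 𝟘 → ∃ λ b → ∀ n → α n ≡ b ^ n
      u≡𝟘⇒powers u≡0 = geometric {u = v} (cubicRoot≢𝟘 fs≡0) λ m →
        ≡.trans (-α≡ m) (≡.trans (cong (λ w → w ⊗ r ^ (N ∸ toℕ m) ⊕ term m s) u≡0)
                                 (≡.trans (cong (_⊕ term m s) (𝔽.zeroˡ (r ^ (N ∸ toℕ m)))) (𝔽.+-identityˡ (term m s))))
      v≡𝟘⇒powers : - 𝟙 - u ≡ 𝟘 → ∃ λ b → ∀ n → α n ≡ b ^ n
      v≡𝟘⇒powers -𝟙-u≡0 = geometric {u = u} (cubicRoot≢𝟘 fr≡0) λ m →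
        ≡.trans (-α≡ m) (≡.trans (cong (λ w → term m r ⊕ w ⊗ s ^ (N ∸ toℕ m)) (≡.trans v≡-𝟙-u -𝟙-u≡0))
                                 (≡.trans (cong (term m r ⊕_) (𝔽.zeroˡ (s ^ (N ∸ toℕ m)))) (𝔽.+-identityʳ (term m r))))

  powers : ∃ λ b → ∀ n → α n ≡ b ^ n
  powers = bySecondRoot (Finₚ.any? λ x → (cubic x ≟ 𝟘) ×-dec ¬? (x ≟ r))
    where
    r = proj₁ root
    bySecondRoot : Dec (∃ λ s → cubic s ≡ 𝟘 × s ≢ r) → ∃ λ b → ∀ n → α n ≡ b ^ n
    bySecondRoot (yes (s , fs≡0 , s≢r)) = TwoRoots.powers (proj₂ root) fs≡0 (s≢r ∘ ≡.sym)
    bySecondRoot (no noOther)           = oneRoot (proj₂ root) λ c c≢r fc≡0 → noOther (c , fc≡0 , c≢r)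

module PrimitiveRoots (N : ℕ) (p-prime : Prime (suc N)) where

  open PrimeField N p-prime
  open ≡-Reasoning

  primitiveRoot≢𝟘 : ∀ {b : Fin (suc N)} → IsPrimitiveRoot b → b ≢ 𝟘
  primitiveRoot≢𝟘 (bᴺ≡𝟙 , _) ≡.refl = 𝟙≢𝟘 (≡.trans (≡.sym bᴺ≡𝟙) (𝟘^n≡𝟘 0<N))

  powers-injective : ∀ {b : Fin (suc N)} → IsPrimitiveRoot b → ∀ {i j} → i < j → j < N → b ^ i ≢ b ^ j
  powers-injective {b} b-primitive@(_ , order) {i} {j} i<j j<N bⁱ≡bʲ =
    order (j ∸ i) (ℕ.m<n⇒0<n∸m i<j) (ℕ.≤-<-trans (ℕ.m∸n≤m j i) j<N) (⊗-cancelˡ (b ^ (j ∸ i)) 𝟙 (^-≢𝟘 i (primitiveRoot≢𝟘 b-primitive)) (begin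
      b ^ i ⊗ b ^ (j ∸ i)          ≡⟨ ^-homo-⊗ b i (j ∸ i) ⟨
      b ^ (i ℕ.+ (j ∸ i))          ≡⟨ cong (b ^_) (ℕ.m+[n∸m]≡n (ℕ.<⇒≤ i<j)) ⟩
      b ^ j                        ≡⟨ bⁱ≡bʲ ⟨
      b ^ i                        ≡⟨ 𝔽.*-identityʳ (b ^ i) ⟨
      b ^ i ⊗ 𝟙                    ∎))

  powers-surjective : ∀ {b : Fin (suc N)} → IsPrimitiveRoot b → ∀ y → y ≢ 𝟘 → ∃ λ i → i < N × b ^ i ≡ y
  powers-surjective {b} b-primitive y y≢0 = fromCollision (Finₚ.pigeonhole ℕ.≤-refl index)
    where
    candidate : Fin (suc N) → Fin (suc N)
    candidate zero    = y
    candidate (suc i) = b ^ toℕ i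
    candidate≢𝟘 : ∀ j → candidate j ≢ 𝟘
    candidate≢𝟘 zero    = y≢0
    candidate≢𝟘 (suc i) = ^-≢𝟘 (toℕ i) (primitiveRoot≢𝟘 b-primitive)
    𝟘≢candidate : ∀ j → 𝟘 ≢ candidate j
    𝟘≢candidate j = candidate≢𝟘 j ∘ ≡.sym
    index : Fin (suc N) → Fin N
    index j = Fin.punchOut (𝟘≢candidate j)
    fromCollision : (∃ λ i → ∃ λ j → i Fin.< j × index i ≡ index j) → ∃ λ i → i < N × b ^ i ≡ y
    fromCollision (zero  , suc j , _   , same) = toℕ j , Finₚ.toℕ<n j , ≡.sym (Finₚ.punchOut-injective (𝟘≢candidate zero) (𝟘≢candidate (suc j)) same)
    fromCollision (suc i , suc j , i<j , same) =
      contradiction (Finₚ.punchOut-injective (𝟘≢candidate (suc i)) (𝟘≢candidate (suc j)) same) (powers-injective b-primitive (ℕ.s≤s⁻¹ i<j) (Finₚ.toℕ<n j))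

module IntegerPowers (N : ℕ) (p-prime : Prime (suc N)) where

  open PrimeField N p-prime
  open ≡-Reasoning

  IsPowZ-unique : ∀ {b : Fin (suc N)} → b ≢ 𝟘 → ∀ z {x y} → IsPowZ b z x → IsPowZ b z y → x ≡ y
  IsPowZ-unique b≢0 (+ k)    x≡bᵏ y≡bᵏ = ≡.trans x≡bᵏ (≡.sym y≡bᵏ)
  IsPowZ-unique b≢0 -[1+ k ] x⊗bᵏ≡𝟙 y⊗bᵏ≡𝟙 = ⊗-cancelʳ _ _ (^-≢𝟘 (suc k) b≢0) (≡.trans x⊗bᵏ≡𝟙 (≡.sym y⊗bᵏ≡𝟙))

  ^-+N : ∀ {b : Fin (suc N)} → b ^ N ≡ 𝟙 → ∀ k → b ^ (k ℕ.+ N) ≡ b ^ k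
  ^-+N {b} bᴺ≡𝟙 k = ≡.trans (^-homo-⊗ b k N) (≡.trans (cong (b ^ k ⊗_) bᴺ≡𝟙) (𝔽.*-identityʳ (b ^ k)))

  IsPowZ-+N : ∀ {b : Fin (suc N)} → b ^ N ≡ 𝟙 → ∀ z {x} → IsPowZ b z x → IsPowZ b (z ℤ.+ + N) x
  IsPowZ-+N {b} bᴺ≡𝟙 (+ k)        x≡bᵏ   = ≡.trans x≡bᵏ (≡.sym (^-+N bᴺ≡𝟙 k))
  IsPowZ-+N {b} bᴺ≡𝟙 -[1+ k ] {x} x⊗bᵏ≡𝟙 = byCases (suc k ℕ.≤? N)
    where
    b≢0 : b ≢ 𝟘
    b≢0 b≡0 = 𝟙≢𝟘 (≡.trans (≡.sym bᴺ≡𝟙) (≡.trans (cong (_^ N) b≡0) (𝟘^n≡𝟘 0<N)))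
    byCases : Dec (suc k ≤ N) → IsPowZ b (N ⊝ suc k) x
    byCases (yes k<N) = ≡.subst (λ z → IsPowZ b z x) (≡.sym (ℤ.⊖-≥ k<N)) (⊗-cancelʳ x (b ^ (N ∸ suc k)) (^-≢𝟘 (suc k) b≢0) (begin
      x ⊗ b ^ suc k                    ≡⟨ x⊗bᵏ≡𝟙 ⟩
      𝟙                                ≡⟨ bᴺ≡𝟙 ⟨
      b ^ N                            ≡⟨ cong (b ^_) (ℕ.m∸n+n≡m k<N) ⟨
      b ^ (N ∸ suc k ℕ.+ suc k)        ≡⟨ ^-homo-⊗ b (N ∸ suc k) (suc k) ⟩
      b ^ (N ∸ suc k) ⊗ b ^ suc k      ∎))
    byCases (no k≮N) = ≡.subst (λ z → IsPowZ b z x) (≡.sym N⊖k) (begin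
      x ⊗ b ^ suc (k ∸ N)              ≡⟨ cong (x ⊗_) (^-+N bᴺ≡𝟙 (suc (k ∸ N))) ⟨
      x ⊗ b ^ (suc (k ∸ N) ℕ.+ N)      ≡⟨ cong (λ e → x ⊗ b ^ suc e) (ℕ.m∸n+n≡m N≤k) ⟩
      x ⊗ b ^ suc k                    ≡⟨ x⊗bᵏ≡𝟙 ⟩
      𝟙                                ∎)
      where
      N≤k : N ≤ k
      N≤k = ℕ.≮⇒≥ k≮N
      N⊖k : N ⊝ suc k ≡ -[1+ k ∸ N ]
      N⊖k = ≡.trans (ℤ.⊖-< (s≤s N≤k)) (cong (λ n → ℤ.- (+ n)) (ℕ.+-∸-assoc 1 N≤k))

module ΦSequences
  (N : ℕ) (p-prime : Prime (suc N)) (2≤N : 2 ≤ N)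
  (a : ℤ → Fin (suc N)) (a₀≡𝟙 : a (+ 0) ≡ 𝟙) (Φ-step : ∀ n → a (n ℤ.+ + (suc N ∸ 3)) ≡ a n ⊕ a (n ℤ.+ + 1))
  where

  open PrimeField N p-prime
  open PrimitiveRoots N p-prime
  open IntegerPowers N p-prime
  open ≡-Reasoning

  PowersOfΦPrimitiveRoot : Set
  PowersOfΦPrimitiveRoot = Σ (Fin (suc N)) λ b → IsΦPrimitiveRoot (suc N ∸ 3) b × (∀ n → IsPowZ b n (a n))

  α : ℕ → Fin (suc N)
  α n = a (+ n)

  complete⇒powers : FewerThan3Roots {suc N} → IsComplete a → PowersOfΦPrimitiveRoot
  complete⇒powers fewerThan3 (periodic , avoids , _) = b , (b-primitive , Φ-root) , powZ
    where
    α-periodic : ∀ n → α (n ℕ.+ N) ≡ α n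
    α-periodic n = periodic (+ n)
    recurrence : ∀ n → α n ≡ α (n ℕ.+ 2) ⊕ α (n ℕ.+ 3)
    recurrence n = begin
      α n                                       ≡⟨ α-periodic n ⟨
      α (n ℕ.+ N)                               ≡⟨ cong α shift ⟩
      a (+ (n ℕ.+ 2) ℤ.+ + (suc N ∸ 3))         ≡⟨ Φ-step (+ (n ℕ.+ 2)) ⟩
      α (n ℕ.+ 2) ⊕ α (n ℕ.+ 2 ℕ.+ 1)           ≡⟨ cong (λ k → α (n ℕ.+ 2) ⊕ α k) (ℕ.+-assoc n 2 1) ⟩
      α (n ℕ.+ 2) ⊕ α (n ℕ.+ 3)                 ∎
      where
      shift : n ℕ.+ N ≡ n ℕ.+ 2 ℕ.+ (N ∸ 2)
      shift = ≡.trans (cong (n ℕ.+_) (≡.sym (ℕ.m+[n∸m]≡n 2≤N))) (≡.sym (ℕ.+-assoc n 2 (N ∸ 2)))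
    avoids′ : ∀ m → 1 ≤ m → m < N → 2 ≤ toℕ (α m)
    avoids′ m 1≤m m<N = avoids m 1≤m (ℕ.∸-monoˡ-≤ 1 m<N)
    open Forward N p-prime 2≤N fewerThan3 α a₀≡𝟙 α-periodic recurrence avoids′ using (powers)
    b : Fin (suc N)
    b = proj₁ powers
    α≡bⁿ : ∀ n → α n ≡ b ^ n
    α≡bⁿ = proj₂ powers
    bᴺ≡𝟙 : b ^ N ≡ 𝟙
    bᴺ≡𝟙 = ≡.trans (≡.sym (α≡bⁿ N)) (≡.trans (α-periodic 0) a₀≡𝟙)
    b-primitive : IsPrimitiveRoot b
    b-primitive = bᴺ≡𝟙 , λ k 1≤k k<N → 2≤toℕ⇒≢𝟙 (≡.subst (λ x → 2 ≤ toℕ x) (α≡bⁿ k) (avoids′ k 1≤k k<N))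
    Φ-root : b ^ (suc N ∸ 3) ≡ b ⊕ 𝟙
    Φ-root = begin
      b ^ (suc N ∸ 3)           ≡⟨ α≡bⁿ (suc N ∸ 3) ⟨
      α (suc N ∸ 3)             ≡⟨ Φ-step (+ 0) ⟩
      α 0 ⊕ α 1                 ≡⟨ cong₂ _⊕_ a₀≡𝟙 (≡.trans (α≡bⁿ 1) (𝔽.*-identityʳ b)) ⟩
      𝟙 ⊕ b                     ≡⟨ 𝔽.+-comm 𝟙 b ⟩
      b ⊕ 𝟙                     ∎
    powZ : ∀ z → IsPowZ b z (a z)
    powZ (+ k)    = α≡bⁿ k
    powZ -[1+ k ] = begin
      a -[1+ k ] ⊗ b ^ suc k                      ≡⟨ cong (_⊗ b ^ suc k) (periodicℤ-iterate a periodic (suc k) -[1+ k ]) ⟨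
      a (-[1+ k ] ℤ.+ + M) ⊗ b ^ suc k            ≡⟨ cong (λ z → a z ⊗ b ^ suc k) (ℤ.⊖-≥ k<M) ⟩
      α (M ∸ suc k) ⊗ b ^ suc k                   ≡⟨ cong (_⊗ b ^ suc k) (α≡bⁿ (M ∸ suc k)) ⟩
      b ^ (M ∸ suc k) ⊗ b ^ suc k                 ≡⟨ ^-homo-⊗ b (M ∸ suc k) (suc k) ⟨
      b ^ (M ∸ suc k ℕ.+ suc k)                   ≡⟨ cong (b ^_) (ℕ.m∸n+n≡m k<M) ⟩
      b ^ M                                       ≡⟨ ^-assocʳ b N (suc k) ⟨
      (b ^ N) ^ suc k                             ≡⟨ cong (_^ suc k) bᴺ≡𝟙 ⟩
      𝟙 ^ suc k                                   ≡⟨ 𝟙^n≡𝟙 (suc k) ⟩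
      𝟙                                           ∎
      where
      M = N ℕ.* suc k
      k<M : suc k ≤ M
      k<M = ℕ.m≤n*m (suc k) N {{ℕ.>-nonZero 0<N}}

  powers⇒complete : PowersOfΦPrimitiveRoot → IsComplete a
  powers⇒complete (b , (b-primitive , _) , powZ) = periodic , avoids , hits
    where
    b≢0 : b ≢ 𝟘
    b≢0 = primitiveRoot≢𝟘 b-primitive
    periodic : ∀ z → a (z ℤ.+ + N) ≡ a z
    periodic z = IsPowZ-unique b≢0 (z ℤ.+ + N) (powZ (z ℤ.+ + N)) (IsPowZ-+N (proj₁ b-primitive) z (powZ z))
    below-N : ∀ {i} → i ≤ N ∸ 1 → i < N
    below-N i≤ = ℕ.≤-<-trans i≤ (ℕ.∸-monoʳ-< (s≤s z≤n) 0<N)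
    avoids : ∀ i → 1 ≤ i → i ≤ N ∸ 1 → 2 ≤ toℕ (a (+ i))
    avoids i 1≤i i≤ = ≡.subst (λ x → 2 ≤ toℕ x) (≡.sym (powZ (+ i)))
                        (≢𝟘∧≢𝟙⇒2≤toℕ (^-≢𝟘 i b≢0) (proj₂ b-primitive i 1≤i (below-N i≤)))
    hit : ∀ {y} → 2 ≤ toℕ y → (∃ λ i → i < N × b ^ i ≡ y) → Σ ℕ λ i → (1 ≤ i) × (i ≤ N ∸ 1) × (a (+ i) ≡ y)
    hit 2≤y (i , i<N , bⁱ≡y) = i , ℕ.n≢0⇒n>0 i≢0 , ℕ.∸-monoˡ-≤ 1 i<N , ≡.trans (powZ (+ i)) bⁱ≡y
      where
      i≢0 : i ≢ 0
      i≢0 i≡0 = 2≤toℕ⇒≢𝟙 2≤y (≡.trans (≡.sym bⁱ≡y) (cong (b ^_) i≡0))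
    hits : ∀ y → 2 ≤ toℕ y → Σ ℕ λ i → (1 ≤ i) × (i ≤ N ∸ 1) × (a (+ i) ≡ y)
    hits y 2≤y = hit 2≤y (powers-surjective b-primitive y (2≤toℕ⇒≢𝟘 2≤y))

mainTheorem10 : (p : ℕ) .{{_ : NonZero p}} → Prime p → 5 ≤ p →
    FewerThan3Roots {p} →
    (a : ℤ → Fin p) → IsΦSeq (p ∸ 3) a →
    (IsComplete a ⇔ Σ (Fin p) λ b → IsΦPrimitiveRoot (p ∸ 3) b × (∀ n → IsPowZ b n (a n)))
mainTheorem10 (suc N) p-prime (s≤s 4≤N) fewerThan3 a (a₀≡𝟙 , Φ-step) =
  mk⇔ (complete⇒powers fewerThan3) powers⇒complete
  where open ΦSequences N p-prime (ℕ.≤-trans (s≤s (s≤s z≤n)) 4≤N) a a₀≡𝟙 Φ-step
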